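{- For finite transition systems $\mathcal{T}$, the model-checking problem $\mathcal{T}\models\varphi$ for SOHyperLTL is decidable when $\varphi$ belongs to any of the following fragments: $\exists^*X\,\forall^*\pi$, $\forall^*X\,\forall^*\pi$, $\exists^*X\,\exists^*\pi$, $\forall^*X\,\exists^*\pi$, and $\exists X.\,\exists^*\pi\in X\,\forall^*\pi'\in X$.
   Context: Fix a finite set $\mathrm{AP}$ and $\Sigma=2^{\mathrm{AP}}$. A transition system $\mathcal{T}=(S,S_0,\kappa,L)$ with labeling $L:S\to\Sigma$ has trace set $\mathit{Traces}(\mathcal{T})\subseteq\Sigma^\omega$ (label sequences of infinite paths from initial states). Path formulas: $\psi ::= a_\pi \mid \neg\psi \mid \psi\wedge\psi \mid \mathsf{X}\psi \mid \psi\,\mathsf{U}\,\psi$, evaluated on trace assignments with the usual synchronous LTL semantics. SOHyperLTL: second-order variables include special $\mathfrak{S},\mathfrak{A}$; syntax $\varphi ::= \mathbb{Q}\pi\in X.\varphi \mid \mathbb{Q}X.\varphi \mid \psi$; $\Pi,\Delta\models\mathbb{Q}\pi\in X.\varphi$ iff $\mathbb{Q}t\in\Delta(X)$: $\Pi[\pi\mapsto t],\Delta\models\varphi$; $\Pi,\Delta\models\mathbb{Q}X.\varphi$ iff $\mathbb{Q}A\subseteq\Sigma^\omega$: $\Pi,\Delta[X\mapsto A]\models\varphi$; $\Pi,\Delta\models\psi$ iff $\Pi\models\psi$. $\mathcal{T}\models\varphi$ iff $\emptyset,[\mathfrak{S}\mapsto\mathit{Traces}(\mathcal{T}),\mathfrak{A}\mapsto\Sigma^\omega]\models\varphi$.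 Fragment notation: $\exists^*X$ (resp. $\forall^*X$) denotes a (possibly empty) sequence of existentially (resp. universally) quantified second-order variables, and $\exists^*\pi$ (resp. $\forall^*\pi$) a sequence of existential (resp. universal) first-order quantifiers $\exists\pi_i\in Y_i$ (resp. $\forall\pi_i\in Y_i$) over second-order variables; e.g. $\exists^*X\,\forall^*\pi$ consists of formulas $\exists X_1\cdots\exists X_n.\forall\pi_1\in Y_1\cdots\forall\pi_m\in Y_m.\psi$ with $\psi$ quantifier-free. The last fragment consists of formulas $\exists X.\exists\pi_1\in X\cdots\exists\pi_k\in X.\forall\pi'_1\in X\cdots\forall\pi'_l\in X.\psi$ with $\psi$ quantifier-free. -}

module Defs where

open import Level using (Level; Lift) renaming (suc to lsuc; zero to lzero)
open import Data.Nat using (ℕ; zero; suc; _+_; _<_)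
open import Data.Fin using (Fin; zero; suc)
open import Data.Bool using (Bool; true; false)
open import Data.Product using (Σ; Σ-syntax; _×_; _,_)
open import Data.Unit using (⊤)
open import Data.Sum using (_⊎_)
open import Data.Vec.Functional using (Vector; _∷_)
open import Relation.Nullary using (¬_)
open import Relation.Binary.PropositionalEquality using (_≡_)

-- Alphabet: AP = Fin n, Σ = 2^AP represented as Fin n → Bool.

Letter : ℕ → Set
Letter n = Fin n → Bool

Trace : ℕ → Set
Trace n = ℕ → Letter n

TraceSet : ℕ → Set₁
TraceSet n = Trace n → Set

record FTS (n : ℕ) : Set where
  field
    states  : ℕ
    initial : Fin states → Bool
    trans   : Fin states → Fin states → Bool
    label   : Fin states → Letter n

Traces : ∀ {n} → FTS n → TraceSet n
Traces T t =
  Σ[ p ∈ (ℕ → Fin (FTS.states T)) ]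
    ( FTS.initial T (p 0) ≡ true
    × (∀ i → FTS.trans T (p i) (p (suc i)) ≡ true)
    × (∀ i a → t i a ≡ FTS.label T (p i) a) )

-- Path formulas over f trace variables (well-scoped de Bruijn).

data PathFormula (n f : ℕ) : Set where
  atom : Fin n → Fin f → PathFormula n f
  neg  : PathFormula n f → PathFormula n f
  and  : PathFormula n f → PathFormula n f → PathFormula n f
  next : PathFormula n f → PathFormula n f
  until : PathFormula n f → PathFormula n f → PathFormula n f

_,_⊨ₚ_ : ∀ {n f} → Vector (Trace n) f → ℕ → PathFormula n f → Set
Π , i ⊨ₚ atom a π = Π π i a ≡ true
Π , i ⊨ₚ neg ψ = ¬ (Π , i ⊨ₚ ψ)
Π , i ⊨ₚ and ψ₁ ψ₂ = (Π , i ⊨ₚ ψ₁) × (Π , i ⊨ₚ ψ₂)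
Π , i ⊨ₚ next ψ = Π , suc i ⊨ₚ ψ
Π , i ⊨ₚ until ψ₁ ψ₂ =
  Σ[ j ∈ ℕ ] ((Π , j + i ⊨ₚ ψ₂) × (∀ k → k < j → Π , k + i ⊨ₚ ψ₁))

data SOVar (s : ℕ) : Set where
  𝔖 : SOVar s
  𝔄 : SOVar s
  var : Fin s → SOVar s

data Formula (n f s : ℕ) : Set where
  ∀π∈_∙_ : SOVar s → Formula n (suc f) s → Formula n f s
  ∃π∈_∙_ : SOVar s → Formula n (suc f) s → Formula n f s
  ∀X∙_   : Formula n f (suc s) → Formula n f s
  ∃X∙_   : Formula n f (suc s) → Formula n f s
  path   : PathFormula n f → Formula n f s

-- Semantics: Π trace assignment, Δ second-order assignment,
-- S the interpretation of 𝔖 (𝔄 is always Σ^ω).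
⟦_⟧ᵛ : ∀ {n s} → SOVar s → TraceSet n → Vector (TraceSet n) s → TraceSet n
⟦ 𝔖 ⟧ᵛ S Δ = S
⟦ 𝔄 ⟧ᵛ S Δ = λ _ → ⊤
⟦ var x ⟧ᵛ S Δ = Δ x

Sat : ∀ {n f s} → TraceSet n → Vector (Trace n) f → Vector (TraceSet n) s →
      Formula n f s → Set₁
Sat S Π Δ (∀π∈ Y ∙ φ) = ∀ t → ⟦ Y ⟧ᵛ S Δ t → Sat S (t ∷ Π) Δ φ
Sat S Π Δ (∃π∈ Y ∙ φ) = Σ[ t ∈ Trace _ ] (⟦ Y ⟧ᵛ S Δ t × Sat S (t ∷ Π) Δ φ)
Sat S Π Δ (∀X∙ φ) = ∀ (A : TraceSet _) → Sat S Π (A ∷ Δ) φ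
Sat S Π Δ (∃X∙ φ) = Σ[ A ∈ TraceSet _ ] Sat S Π (A ∷ Δ) φ
Sat S Π Δ (path ψ) = Lift (lsuc lzero) (Π , 0 ⊨ₚ ψ)

Sentence : ℕ → Set
Sentence n = Formula n 0 0

private
  emptyV : ∀ {a} {A : Set a} → Vector A 0
  emptyV ()

_⊨_ : ∀ {n} → FTS n → Sentence n → Set₁
T ⊨ φ = Sat (Traces T) emptyV emptyV φ

data ForallFO {n} : ∀ {f s} → Formula n f s → Set where
  base : ∀ {f s} (ψ : PathFormula n f) → ForallFO {f = f} {s} (path ψ)
  step : ∀ {f s} Y {φ : Formula n (suc f) s} → ForallFO φ → ForallFO (∀π∈ Y ∙ φ)

data ExistsFO {n} : ∀ {f s} → Formula n f s → Set where
  base : ∀ {f s} (ψ : PathFormula n f) → ExistsFO {f = f} {s} (path ψ)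
  step : ∀ {f s} Y {φ : Formula n (suc f) s} → ExistsFO φ → ExistsFO (∃π∈ Y ∙ φ)

data ExistsSO {n} (P : ∀ {f s} → Formula n f s → Set) :
              ∀ {f s} → Formula n f s → Set where
  base : ∀ {f s} {φ : Formula n f s} → P φ → ExistsSO P φ
  step : ∀ {f s} {φ : Formula n f (suc s)} → ExistsSO P φ → ExistsSO P (∃X∙ φ)

data ForallSO {n} (P : ∀ {f s} → Formula n f s → Set) :
              ∀ {f s} → Formula n f s → Set where
  base : ∀ {f s} {φ : Formula n f s} → P φ → ForallSO P φ
  step : ∀ {f s} {φ : Formula n f (suc s)} → ForallSO P φ → ForallSO P (∀X∙ φ)

data ForallIn {n s} (x : Fin s) : ∀ {f} → Formula n f s → Set where
  base : ∀ {f} (ψ : PathFormula n f) → ForallIn x {f} (path ψ)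
  step : ∀ {f} {φ : Formula n (suc f) s} → ForallIn x φ → ForallIn x (∀π∈ var x ∙ φ)

data ExistsForallIn {n s} (x : Fin s) : ∀ {f} → Formula n f s → Set where
  base : ∀ {f} {φ : Formula n f s} → ForallIn x φ → ExistsForallIn x φ
  step : ∀ {f} {φ : Formula n (suc f) s} → ExistsForallIn x φ →
         ExistsForallIn x (∃π∈ var x ∙ φ)

data InFragment {n} : Sentence n → Set where
  ∃X∀π  : ∀ {φ} → ExistsSO ForallFO φ → InFragment φ
  ∀X∀π  : ∀ {φ} → ForallSO ForallFO φ → InFragment φ
  ∃X∃π  : ∀ {φ} → ExistsSO ExistsFO φ → InFragment φ
  ∀X∃π  : ∀ {φ} → ForallSO ExistsFO φ → InFragment φ
  ∃X∃π∀π : ∀ {φ} → ExistsForallIn zero φ → InFragment (∃X∙ φ)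

module Submission where

-- A formula whose trace quantifiers are all existential (all universal) is
-- monotone (antitone) in the sets its second-order variables denote, so ∃X
-- and ∀X can be instantiated by Σ^ω or ∅. What remains quantifies over the
-- traces of finite structures (the system, Σ^ω, ∅), so it asks whether some
-- or every path of a product Kripke structure satisfies an LTL formula; this
-- is decided by searching the product with an LTL tableau for a fair lasso.
-- In ∃X.∃π∈X.∀π′∈X.ψ the set X may be shrunk to the existential witnesses,
-- which turns the universal quantifiers into a finite conjunction of
-- instances of ψ. Excluded middle is needed only to show that the lasso
-- search is complete.

open import Defs

open import Axiom.ExcludedMiddle using (ExcludedMiddle)
open import Data.Bool using (Bool; true; false; T; not; _∧_; _∨_)
open import Data.Bool.ListAction using (any; all)
open import Data.Bool.Properties using (T-≡; T-∧; T-∨) renaming (_≟_ to _≟ᵇ_)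
open import Data.Empty using (⊥; ⊥-elim)
open import Data.Fin using (Fin; zero; suc; toℕ)
import Data.Fin.Properties as Fin
open import Data.List
  using (List; []; _∷_; _++_; _∷ʳ_; map; concat; length; lookup; allFin; upTo;
         cartesianProduct; cartesianProductWith)
open import Data.List.Extrema.Nat using (max; v≤max⁺)
open import Data.List.Membership.Propositional using (_∈_; lose)
open import Data.List.Membership.Propositional.Properties
  using (∈-upTo⁺; ∈-∃++; ∈-map⁺; ∈-map⁻; ∈-++⁺ˡ; ∈-++⁺ʳ; ∈-allFin;
         ∈-cartesianProduct⁺; ∈-cartesianProductWith⁺)
open import Data.List.Properties using (++-assoc)
open import Data.List.Relation.Binary.Permutation.Propositional using (_↭_; ↭-refl; ↭-sym)
open import Data.List.Relation.Binary.Permutation.Propositional.Properties using (∷↭∷ʳ; ∈-resp-↭)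
open import Data.List.Relation.Unary.All using (All; []; _∷_)
import Data.List.Relation.Unary.All as All
open import Data.List.Relation.Unary.All.Properties
  using (all⁺; all⁻; concat⁺; concat⁻) renaming (map⁺ to All-map⁺; map⁻ to All-map⁻)
open import Data.List.Relation.Unary.Any using (here; there; index; satisfied)
open import Data.List.Relation.Unary.Any.Properties using (any⁺; any⁻; lookup-index)
open import Data.Maybe using (Maybe; just; nothing; _<∣>_; maybe′; Is-just)
import Data.Maybe as Maybe
open import Data.Maybe.Relation.Unary.Any using (just)
open import Data.Nat using (ℕ; zero; suc; _+_; _∸_; _<_; _≤_; z≤n; s≤s; _≤?_; _≤′_; ≤′-refl; ≤′-step)
open import Data.Nat.Induction using (<-rec)
open import Data.Nat.Properties
  using (≤-refl; ≤-reflexive; ≤-trans; ≤-antisym; ≤-pred; <-≤-trans; ≤-<-trans; ≰⇒>; ≤⇒≤′;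
         n≤1+n; n<1+n; 1+n≰n; m≤m+n; m≤n+m; m<m+n; m≤n⇒m≤1+n; m≤n⇒∃[o]m+o≡n; m∸n+n≡m;
         +-suc; +-comm; +-identityʳ; +-monoʳ-≤; +-monoˡ-<)
open import Data.Nat.Tactic.RingSolver using (solve-∀)
open import Data.Product using (Σ-syntax; ∃; _×_; _,_; proj₁; proj₂)
open import Data.Product.Function.NonDependent.Propositional using (_×-⇔_)
import Data.Product.Properties as Product
open import Data.Sum using (_⊎_; inj₁; inj₂; map₁)
open import Data.Sum.Function.Propositional using (_⊎-⇔_)
open import Data.Unit using (⊤; tt)
import Data.Unit.Properties as Unit
open import Data.Vec using (Vec; []; _∷_)
import Data.Vec as Vec
import Data.Vec.Properties as Vecₚ
open import Data.Vec.Functional using (Vector) renaming (_∷_ to _∷ᵛ_)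
open import Function using (_∘_; id)
open import Function.Bundles using (_⇔_; mk⇔; Equivalence)
open import Function.Construct.Composition using (_⇔-∘_)
open import Function.Construct.Identity using (⇔-id)
open import Function.Construct.Symmetry using (⇔-sym)
open import Function.Related.Propositional using (module EquationalReasoning)
open import Function.Related.TypeIsomorphisms using (¬-cong-⇔)
open import Level using (lift; lower) renaming (suc to lsuc; zero to lzero)
open import Relation.Binary using (DecidableEquality)
open import Relation.Binary.PropositionalEquality using (_≡_; refl; sym; trans; cong; subst; subst₂)
open import Relation.Nullary using (¬_; Dec; yes; no; _×-dec_)
open import Relation.Nullary.Decidable using (⌊_⌋; T?; toWitness; fromWitness; map′; decidable-stable)
open import Relation.Unary using (_⊆_; _⊇_)

open Equivalence using (to; from)

record FinSet : Set₁ where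
  field
    Carrier  : Set
    _≟_      : DecidableEquality Carrier
    elements : List Carrier
    complete : ∀ x → x ∈ elements

  size : ℕ
  size = length elements

  encode : Carrier → Fin size
  encode x = index (complete x)

  encode-injective : ∀ {x y} → encode x ≡ encode y → x ≡ y
  encode-injective {x} {y} eq =
    trans (lookup-index (complete x)) (trans (cong (lookup elements) eq) (sym (lookup-index (complete y))))

  exists : (Carrier → Bool) → Bool
  exists p = any p elements

  exists-sound : ∀ p → T (exists p) → ∃ (T ∘ p)
  exists-sound p = satisfied ∘ any⁻ p elements

  exists-complete : ∀ p x → T (p x) → T (exists p)
  exists-complete p x = any⁺ p ∘ lose (complete x)

open FinSet public

_×ᶠ_ : FinSet → FinSet → FinSet
A ×ᶠ B = record
  { Carrier  = Carrier A × Carrier B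
  ; _≟_      = Product.≡-dec (_≟_ A) (_≟_ B)
  ; elements = cartesianProduct (elements A) (elements B)
  ; complete = λ (x , y) → ∈-cartesianProduct⁺ (complete A x) (complete B y)
  }

⊤ᶠ : FinSet
⊤ᶠ = record { Carrier = ⊤ ; _≟_ = Unit._≟_ ; elements = tt ∷ [] ; complete = λ _ → here refl }

Boolᶠ : FinSet
Boolᶠ = record
  { Carrier = Bool ; _≟_ = _≟ᵇ_ ; elements = true ∷ false ∷ []
  ; complete = λ { true → here refl ; false → there (here refl) } }

Finᶠ : ℕ → FinSet
Finᶠ m = record { Carrier = Fin m ; _≟_ = Fin._≟_ ; elements = allFin m ; complete = ∈-allFin }

Vecᶠ : FinSet → ℕ → FinSet
Vecᶠ A m = record
  { Carrier = Vec (Carrier A) m ; _≟_ = Vecₚ.≡-dec (_≟_ A) ; elements = vectors m ; complete = ∈-vectors }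
  where
  vectors : ∀ m → List (Vec (Carrier A) m)
  vectors zero    = [] ∷ []
  vectors (suc m) = cartesianProductWith _∷_ (elements A) (vectors m)

  ∈-vectors : ∀ {m} (v : Vec (Carrier A) m) → v ∈ vectors m
  ∈-vectors []       = here refl
  ∈-vectors (x ∷ v) = ∈-cartesianProductWith⁺ _∷_ (complete A x) (∈-vectors v)

Until : (ℕ → Set) → (ℕ → Set) → ℕ → Set
Until P Q i = Σ[ j ∈ ℕ ] (Q (j + i) × (∀ k → k < j → P (k + i)))

module _ {P Q : ℕ → Set} where

  Until-shift : ∀ {i} j → Q (suc j + i) → (∀ k → k < suc j → P (k + i)) →
                Q (j + suc i) × (∀ k → k < j → P (k + suc i))
  Until-shift {i} j q ps =
    subst Q (sym (+-suc j i)) q , λ k k<j → subst P (sym (+-suc k i)) (ps (suc k) (s≤s k<j))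

  Until-unfold : ∀ i → Until P Q i ⇔ (Q i ⊎ (P i × Until P Q (suc i)))
  Until-unfold i = mk⇔ unfold fold
    where
    unfold : Until P Q i → Q i ⊎ (P i × Until P Q (suc i))
    unfold (zero , q , _)    = inj₁ q
    unfold (suc j , q , ps) = inj₂ (ps 0 (s≤s z≤n) , j , Until-shift j q ps)

    fold : Q i ⊎ (P i × Until P Q (suc i)) → Until P Q i
    fold (inj₁ q)                = 0 , q , λ _ ()
    fold (inj₂ (p , j , q , ps)) =
      suc j , subst Q (+-suc j i) q ,
      λ { zero _ → p ; (suc k) (s≤s k<j) → subst P (+-suc k i) (ps k k<j) }

  -- Until P Q is the least solution of its unfolding equation, and a
  -- solution B that implies eventually Q is also below it.
  Until-least : {B : ℕ → Set} →
                (∀ i → B i ⇔ (Q i ⊎ (P i × B (suc i)))) →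
                (∀ i → B i → ∃ λ j → Q (j + i)) →
                ∀ i → B i ⇔ Until P Q i
  Until-least {B} unfolds eventually i =
    mk⇔ (λ b → necessary (proj₁ (eventually i b)) i b (proj₂ (eventually i b)))
        (λ (j , q , ps) → sufficient j i q ps)
    where
    necessary : ∀ j i → B i → Q (j + i) → Until P Q i
    necessary zero    i _ q = 0 , q , λ _ ()
    necessary (suc j) i b q with to (unfolds i) b
    ... | inj₁ q′       = 0 , q′ , λ _ ()
    ... | inj₂ (p , b′) =
      from (Until-unfold i) (inj₂ (p , necessary j (suc i) b′ (subst Q (sym (+-suc j i)) q)))

    sufficient : ∀ j i → Q (j + i) → (∀ k → k < j → P (k + i)) → B i
    sufficient zero    i q _  = from (unfolds i) (inj₁ q)
    sufficient (suc j) i q ps =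
      from (unfolds i) (inj₂ (ps 0 (s≤s z≤n) , sufficient j (suc i) (proj₁ shifted) (proj₂ shifted)))
      where
      shifted : Q (j + suc i) × (∀ k → k < j → P (k + suc i))
      shifted = Until-shift j q ps

T-not : ∀ {b} → T (not b) ⇔ (¬ T b)
T-not {true}  = mk⇔ (λ ()) (λ f → f tt)
T-not {false} = mk⇔ (λ _ ()) (λ _ → tt)

T-injective : ∀ {b c} → T b ⇔ T c → b ≡ c
T-injective {true}  {true}  _ = refl
T-injective {true}  {false} e = ⊥-elim (to e tt)
T-injective {false} {true}  e = ⊥-elim (from e tt)
T-injective {false} {false} _ = refl

T-cong : ∀ {b c} → b ≡ c → T b ⇔ T c
T-cong refl = ⇔-id _

T-⌊⌋ : ∀ {P : Set} (d : Dec P) → T ⌊ d ⌋ ⇔ P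
T-⌊⌋ d = mk⇔ toWitness fromWitness

Letters : ℕ → ℕ → Set
Letters n k = Fin k → Letter n

letters : ∀ {n k} → Vector (Trace n) k → ℕ → Letters n k
letters Π i π = Π π i

module Tableau {n k : ℕ} where

  -- A label guesses a truth value for every subformula occurrence; the
  -- first component is the guess for the formula itself.
  labelSet : PathFormula n k → FinSet
  labelSet (atom a π)  = Boolᶠ
  labelSet (neg φ)     = Boolᶠ ×ᶠ labelSet φ
  labelSet (and φ χ)   = Boolᶠ ×ᶠ (labelSet φ ×ᶠ labelSet χ)
  labelSet (next φ)    = Boolᶠ ×ᶠ labelSet φ
  labelSet (until φ χ) = Boolᶠ ×ᶠ (labelSet φ ×ᶠ labelSet χ)

  Label : PathFormula n k → Set
  Label φ = Carrier (labelSet φ)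

  holds : ∀ φ → Label φ → Bool
  holds (atom a π)  b       = b
  holds (neg φ)     (b , _) = b
  holds (and φ χ)   (b , _) = b
  holds (next φ)    (b , _) = b
  holds (until φ χ) (b , _) = b

  Follows : Letters n k → ∀ φ → Label φ → Label φ → Set
  Follows L (atom a π)  b           _              = b ≡ L π a
  Follows L (neg φ)     (b , ℓ)     (_ , ℓ′)       = b ≡ not (holds φ ℓ) × Follows L φ ℓ ℓ′
  Follows L (and φ χ)   (b , ℓ , m) (_ , ℓ′ , m′)  =
    b ≡ (holds φ ℓ ∧ holds χ m) × Follows L φ ℓ ℓ′ × Follows L χ m m′
  Follows L (next φ)    (b , ℓ)     (_ , ℓ′)       = b ≡ holds φ ℓ′ × Follows L φ ℓ ℓ′
  Follows L (until φ χ) (b , ℓ , m) (b′ , ℓ′ , m′) =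
    b ≡ (holds χ m ∨ (holds φ ℓ ∧ b′)) × Follows L φ ℓ ℓ′ × Follows L χ m m′

  follows? : ∀ L φ ℓ ℓ′ → Dec (Follows L φ ℓ ℓ′)
  follows? L (atom a π)  b           _              = b ≟ᵇ L π a
  follows? L (neg φ)     (b , ℓ)     (_ , ℓ′)       = (b ≟ᵇ _) ×-dec follows? L φ ℓ ℓ′
  follows? L (and φ χ)   (b , ℓ , m) (_ , ℓ′ , m′)  =
    (b ≟ᵇ _) ×-dec follows? L φ ℓ ℓ′ ×-dec follows? L χ m m′
  follows? L (next φ)    (b , ℓ)     (_ , ℓ′)       = (b ≟ᵇ _) ×-dec follows? L φ ℓ ℓ′
  follows? L (until φ χ) (b , ℓ , m) (b′ , ℓ′ , m′) =
    (b ≟ᵇ _) ×-dec follows? L φ ℓ ℓ′ ×-dec follows? L χ m m′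

  -- The occurrences of until-subformulas. Such an occurrence is pending
  -- where its guess is true and fulfilled where the guess for its right
  -- operand is true.
  Eventuality : PathFormula n k → Set
  Eventuality (atom a π)  = ⊥
  Eventuality (neg φ)     = Eventuality φ
  Eventuality (and φ χ)   = Eventuality φ ⊎ Eventuality χ
  Eventuality (next φ)    = Eventuality φ
  Eventuality (until φ χ) = ⊤ ⊎ (Eventuality φ ⊎ Eventuality χ)

  eventualities : ∀ φ → List (Eventuality φ)
  eventualities (atom a π)  = []
  eventualities (neg φ)     = eventualities φ
  eventualities (and φ χ)   = map inj₁ (eventualities φ) ++ map inj₂ (eventualities χ)
  eventualities (next φ)    = eventualities φ
  eventualities (until φ χ) =
    inj₁ tt ∷ map inj₂ (map inj₁ (eventualities φ) ++ map inj₂ (eventualities χ))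

  ∈-eventualities : ∀ φ e → e ∈ eventualities φ
  ∈-eventualities (atom a π)  ()
  ∈-eventualities (neg φ)     e        = ∈-eventualities φ e
  ∈-eventualities (and φ χ)   (inj₁ e) = ∈-++⁺ˡ (∈-map⁺ inj₁ (∈-eventualities φ e))
  ∈-eventualities (and φ χ)   (inj₂ e) =
    ∈-++⁺ʳ (map inj₁ (eventualities φ)) (∈-map⁺ inj₂ (∈-eventualities χ e))
  ∈-eventualities (next φ)    e        = ∈-eventualities φ e
  ∈-eventualities (until φ χ) (inj₁ _) = here refl
  ∈-eventualities (until φ χ) (inj₂ e) = there (∈-map⁺ inj₂ (∈-eventualities (and φ χ) e))

  pending : ∀ φ → Label φ → Eventuality φ → Bool
  pending (neg φ)     (_ , ℓ)     e               = pending φ ℓ e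
  pending (and φ χ)   (_ , ℓ , m) (inj₁ e)        = pending φ ℓ e
  pending (and φ χ)   (_ , ℓ , m) (inj₂ e)        = pending χ m e
  pending (next φ)    (_ , ℓ)     e               = pending φ ℓ e
  pending (until φ χ) (b , _)     (inj₁ _)        = b
  pending (until φ χ) (_ , ℓ , m) (inj₂ (inj₁ e)) = pending φ ℓ e
  pending (until φ χ) (_ , ℓ , m) (inj₂ (inj₂ e)) = pending χ m e

  fulfilled : ∀ φ → Label φ → Eventuality φ → Bool
  fulfilled (neg φ)     (_ , ℓ)     e               = fulfilled φ ℓ e
  fulfilled (and φ χ)   (_ , ℓ , m) (inj₁ e)        = fulfilled φ ℓ e
  fulfilled (and φ χ)   (_ , ℓ , m) (inj₂ e)        = fulfilled χ m e
  fulfilled (next φ)    (_ , ℓ)     e               = fulfilled φ ℓ e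
  fulfilled (until φ χ) (_ , _ , m) (inj₁ _)        = holds χ m
  fulfilled (until φ χ) (_ , ℓ , m) (inj₂ (inj₁ e)) = fulfilled φ ℓ e
  fulfilled (until φ χ) (_ , ℓ , m) (inj₂ (inj₂ e)) = fulfilled χ m e

  pending-persists : ∀ {L} φ {ℓ ℓ′} e → Follows L φ ℓ ℓ′ →
                     T (pending φ ℓ e) → ¬ T (fulfilled φ ℓ e) → T (pending φ ℓ′ e)
  pending-persists (neg φ)     e               (_ , f)     = pending-persists φ e f
  pending-persists (and φ χ)   (inj₁ e)        (_ , f , _) = pending-persists φ e f
  pending-persists (and φ χ)   (inj₂ e)        (_ , _ , g) = pending-persists χ e g
  pending-persists (next φ)    e               (_ , f)     = pending-persists φ e f
  pending-persists (until φ χ) (inj₁ _)        (b≡ , _) p ¬f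
    with to T-∨ (subst T b≡ p)
  ... | inj₁ f     = ⊥-elim (¬f f)
  ... | inj₂ φ∧b′ = proj₂ (to T-∧ φ∧b′)
  pending-persists (until φ χ) (inj₂ (inj₁ e)) (_ , f , _) = pending-persists φ e f
  pending-persists (until φ χ) (inj₂ (inj₂ e)) (_ , _ , g) = pending-persists χ e g

  IsRun : Vector (Trace n) k → ∀ φ → (ℕ → Label φ) → Set
  IsRun Π φ ℓ = ∀ i → Follows (letters Π i) φ (ℓ i) (ℓ (suc i))

  IsFair : ∀ φ → (ℕ → Label φ) → Set
  IsFair φ ℓ = ∀ i e → T (pending φ (ℓ i) e) → ∃ λ j → T (fulfilled φ (ℓ (j + i)) e)

  module _ (Π : Vector (Trace n) k) where
    open EquationalReasoning

    run-holds : ∀ φ {ℓ} → IsRun Π φ ℓ → IsFair φ ℓ → ∀ i → T (holds φ (ℓ i)) ⇔ (Π , i ⊨ₚ φ)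
    run-holds (atom a π) {ℓ} run _ i = begin
      T (ℓ i)        ∼⟨ T-cong (run i) ⟩
      T (Π π i a)    ∼⟨ T-≡ ⟩
      (Π π i a ≡ true) ∎
    run-holds (neg φ) {ℓ} run fair i = begin
      T (proj₁ (ℓ i))                 ∼⟨ T-cong (proj₁ (run i)) ⟩
      T (not (holds φ (proj₂ (ℓ i)))) ∼⟨ T-not ⟩
      (¬ T (holds φ (proj₂ (ℓ i))))   ∼⟨ ¬-cong-⇔ (run-holds φ (proj₂ ∘ run) fair i) ⟩
      (¬ (Π , i ⊨ₚ φ))                ∎
    run-holds (and φ χ) {ℓ} run fair i = begin
      T (proj₁ (ℓ i))                       ∼⟨ T-cong (proj₁ (run i)) ⟩
      T (holds φ (ℓφ i) ∧ holds χ (ℓχ i))   ∼⟨ T-∧ ⟩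
      (T (holds φ (ℓφ i)) × T (holds χ (ℓχ i))) ∼⟨ IHφ ×-⇔ IHχ ⟩
      ((Π , i ⊨ₚ φ) × (Π , i ⊨ₚ χ))         ∎
      where
      ℓφ : ℕ → Label φ
      ℓφ = proj₁ ∘ proj₂ ∘ ℓ
      ℓχ : ℕ → Label χ
      ℓχ = proj₂ ∘ proj₂ ∘ ℓ
      IHφ : T (holds φ (ℓφ i)) ⇔ (Π , i ⊨ₚ φ)
      IHφ = run-holds φ (proj₁ ∘ proj₂ ∘ run) (λ j e → fair j (inj₁ e)) i
      IHχ : T (holds χ (ℓχ i)) ⇔ (Π , i ⊨ₚ χ)
      IHχ = run-holds χ (proj₂ ∘ proj₂ ∘ run) (λ j e → fair j (inj₂ e)) i
    run-holds (next φ) {ℓ} run fair i = begin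
      T (proj₁ (ℓ i))                       ∼⟨ T-cong (proj₁ (run i)) ⟩
      T (holds φ (proj₂ (ℓ (suc i))))       ∼⟨ run-holds φ (proj₂ ∘ run) fair (suc i) ⟩
      (Π , suc i ⊨ₚ φ)                      ∎
    run-holds (until φ χ) {ℓ} run fair = Until-least unfolds eventually
      where
      b : ℕ → Bool
      b = proj₁ ∘ ℓ
      ℓφ : ℕ → Label φ
      ℓφ = proj₁ ∘ proj₂ ∘ ℓ
      ℓχ : ℕ → Label χ
      ℓχ = proj₂ ∘ proj₂ ∘ ℓ
      IHφ : ∀ i → T (holds φ (ℓφ i)) ⇔ (Π , i ⊨ₚ φ)
      IHφ = run-holds φ (proj₁ ∘ proj₂ ∘ run) (λ j e → fair j (inj₂ (inj₁ e)))
      IHχ : ∀ i → T (holds χ (ℓχ i)) ⇔ (Π , i ⊨ₚ χ)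
      IHχ = run-holds χ (proj₂ ∘ proj₂ ∘ run) (λ j e → fair j (inj₂ (inj₂ e)))

      unfolds : ∀ i → T (b i) ⇔ ((Π , i ⊨ₚ χ) ⊎ ((Π , i ⊨ₚ φ) × T (b (suc i))))
      unfolds i = begin
        T (b i)                                              ∼⟨ T-cong (proj₁ (run i)) ⟩
        T (holds χ (ℓχ i) ∨ (holds φ (ℓφ i) ∧ b (suc i)))    ∼⟨ T-∨ ⟩
        (T (holds χ (ℓχ i)) ⊎ T (holds φ (ℓφ i) ∧ b (suc i))) ∼⟨ ⇔-id _ ⊎-⇔ T-∧ ⟩
        (T (holds χ (ℓχ i)) ⊎ (T (holds φ (ℓφ i)) × T (b (suc i))))
                                                 ∼⟨ IHχ i ⊎-⇔ (IHφ i ×-⇔ ⇔-id _) ⟩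
        ((Π , i ⊨ₚ χ) ⊎ ((Π , i ⊨ₚ φ) × T (b (suc i))))      ∎

      eventually : ∀ i → T (b i) → ∃ λ j → Π , j + i ⊨ₚ χ
      eventually i bᵢ with fair i (inj₁ tt) bᵢ
      ... | j , hχ = j , to (IHχ (j + i)) hχ

  -- The labelling by actual truth values, which needs excluded middle to
  -- decide the until-subformulas.
  module Canonical (em : ExcludedMiddle lzero) (Π : Vector (Trace n) k) where
    open EquationalReasoning

    canonical : ∀ φ → ℕ → Label φ
    canonical (atom a π)  i = Π π i a
    canonical (neg φ)     i = not (holds φ (canonical φ i)) , canonical φ i
    canonical (and φ χ)   i =
      (holds φ (canonical φ i) ∧ holds χ (canonical χ i)) , canonical φ i , canonical χ i
    canonical (next φ)    i = holds φ (canonical φ (suc i)) , canonical φ i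
    canonical (until φ χ) i = ⌊ em {Π , i ⊨ₚ until φ χ} ⌋ , canonical φ i , canonical χ i

    canonical-holds : ∀ φ i → T (holds φ (canonical φ i)) ⇔ (Π , i ⊨ₚ φ)
    canonical-holds (atom a π)  i = T-≡
    canonical-holds (neg φ)     i = ¬-cong-⇔ (canonical-holds φ i) ⇔-∘ T-not
    canonical-holds (and φ χ)   i = (canonical-holds φ i ×-⇔ canonical-holds χ i) ⇔-∘ T-∧
    canonical-holds (next φ)    i = canonical-holds φ (suc i)
    canonical-holds (until φ χ) i = T-⌊⌋ em

    canonical-run : ∀ φ → IsRun Π φ (canonical φ)
    canonical-run (atom a π)  i = refl
    canonical-run (neg φ)     i = refl , canonical-run φ i
    canonical-run (and φ χ)   i = refl , canonical-run φ i , canonical-run χ i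
    canonical-run (next φ)    i = refl , canonical-run φ i
    canonical-run (until φ χ) i = T-injective unfold-eq , canonical-run φ i , canonical-run χ i
      where
      hφ hχ b′ : Bool
      hφ = holds φ (canonical φ i)
      hχ = holds χ (canonical χ i)
      b′ = ⌊ em {Π , suc i ⊨ₚ until φ χ} ⌋
      unfold-eq : T ⌊ em {Π , i ⊨ₚ until φ χ} ⌋ ⇔ T (hχ ∨ (hφ ∧ b′))
      unfold-eq = begin
        T ⌊ em ⌋                                                  ∼⟨ T-⌊⌋ em ⟩
        (Π , i ⊨ₚ until φ χ)                        ∼⟨ Until-unfold {λ j → Π , j ⊨ₚ φ} {λ j → Π , j ⊨ₚ χ} i ⟩
        ((Π , i ⊨ₚ χ) ⊎ ((Π , i ⊨ₚ φ) × (Π , suc i ⊨ₚ until φ χ)))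
                ∼⟨ ⇔-sym (canonical-holds χ i ⊎-⇔ (canonical-holds φ i ×-⇔ T-⌊⌋ em)) ⟩
        (T hχ ⊎ (T hφ × T b′))                                    ∼⟨ ⇔-sym (⇔-id _ ⊎-⇔ T-∧) ⟩
        (T hχ ⊎ T (hφ ∧ b′))                                      ∼⟨ ⇔-sym T-∨ ⟩
        T (hχ ∨ (hφ ∧ b′))                                        ∎

    canonical-fair : ∀ φ → IsFair φ (canonical φ)
    canonical-fair (neg φ)     i e               = canonical-fair φ i e
    canonical-fair (and φ χ)   i (inj₁ e)        = canonical-fair φ i e
    canonical-fair (and φ χ)   i (inj₂ e)        = canonical-fair χ i e
    canonical-fair (next φ)    i e               = canonical-fair φ i e
    canonical-fair (until φ χ) i (inj₁ _) p with to (T-⌊⌋ em) p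
    ... | j , hχ , _ = j , from (canonical-holds χ (j + i)) hχ
    canonical-fair (until φ χ) i (inj₂ (inj₁ e)) = canonical-fair φ i e
    canonical-fair (until φ χ) i (inj₂ (inj₂ e)) = canonical-fair χ i e

module Reachability (A : FinSet) (edge : Carrier A → Carrier A → Bool) where

  Walk : Carrier A → List (Carrier A) → Carrier A → Set
  Walk a []       b = a ≡ b
  Walk a (c ∷ cs) b = T (edge a c) × Walk c cs b

  walk-++ : ∀ {a b c} xs {ys} → Walk a xs b → Walk b ys c → Walk a (xs ++ ys) c
  walk-++ []       refl       w′ = w′
  walk-++ (x ∷ xs) (e , w) w′ = e , walk-++ xs w w′

  reachableIn : ℕ → Carrier A → Carrier A → Bool
  reachableIn zero    a b = ⌊ _≟_ A a b ⌋
  reachableIn (suc t) a b = exists A (λ c → edge a c ∧ reachableIn t c b)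

  reachable : Carrier A → Carrier A → Bool
  reachable a b = any (λ t → reachableIn t a b) (upTo (suc (size A)))

  reachableIn-sound : ∀ t {a b} → T (reachableIn t a b) → ∃ λ cs → Walk a cs b
  reachableIn-sound zero    r = [] , toWitness r
  reachableIn-sound (suc t) r with exists-sound A _ r
  ... | c , e∧r with to T-∧ e∧r
  ... | e , r′ with reachableIn-sound t r′
  ... | cs , w = c ∷ cs , e , w

  reachable-sound : ∀ {a b} → T (reachable a b) → ∃ λ cs → Walk a cs b
  reachable-sound {a} {b} r with satisfied (any⁻ _ (upTo (suc (size A))) r)
  ... | t , r′ = reachableIn-sound t r′

  IsWalk : (ℕ → Carrier A) → ℕ → Set
  IsWalk w t = ∀ x → x < t → T (edge (w x) (w (suc x)))

  reachableIn-complete : ∀ t w → IsWalk w t → T (reachableIn t (w 0) (w t))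
  reachableIn-complete zero    w _    = fromWitness refl
  reachableIn-complete (suc t) w walk =
    exists-complete A _ (w 1)
      (from T-∧ (walk 0 (s≤s z≤n) , reachableIn-complete t (w ∘ suc) (λ x x<t → walk (suc x) (s≤s x<t))))

  -- Cutting out the segment (i , i + d] of a walk that revisits w i at i + d.
  skip : (ℕ → Carrier A) → ℕ → ℕ → ℕ → Carrier A
  skip w i d x with x ≤? i
  ... | yes _ = w x
  ... | no  _ = w (x + d)

  skip-≤ : ∀ w {i d x} → x ≤ i → skip w i d x ≡ w x
  skip-≤ w {i} {d} {x} x≤i with x ≤? i
  ... | yes _   = refl
  ... | no  x≰i = ⊥-elim (x≰i x≤i)

  skip-> : ∀ w {i d x} → ¬ x ≤ i → skip w i d x ≡ w (x + d)
  skip-> w {i} {d} {x} x≰i with x ≤? i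
  ... | yes x≤i = ⊥-elim (x≰i x≤i)
  ... | no  _   = refl

  skip-walk : ∀ w {i d t} → w i ≡ w (i + d) → IsWalk w (t + d) → IsWalk (skip w i d) t
  skip-walk w {i} {d} {t} loop walk x x<t = by-cases (x ≤? i) (suc x ≤? i)
    where
    edge-at : Carrier A → Carrier A → Set
    edge-at a b = T (edge a b)

    by-cases : Dec (x ≤ i) → Dec (suc x ≤ i) → T (edge (skip w i d x) (skip w i d (suc x)))
    by-cases (yes x≤i) (yes sx≤i) =
      subst₂ edge-at (sym (skip-≤ w x≤i)) (sym (skip-≤ w sx≤i))
        (walk x (<-≤-trans x<t (m≤m+n t d)))
    by-cases (yes x≤i) (no sx≰i) =
      subst₂ edge-at (sym (trans (skip-≤ w x≤i) (trans (cong w x≡i) loop)))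
        (sym (trans (skip-> w sx≰i) (cong (λ y → w (suc y + d)) x≡i)))
        (walk (i + d) (+-monoˡ-< d (subst (_< t) x≡i x<t)))
      where
      x≡i : x ≡ i
      x≡i = ≤-antisym x≤i (≤-pred (≰⇒> sx≰i))
    by-cases (no x≰i) (yes sx≤i) = ⊥-elim (x≰i (≤-trans (n≤1+n x) sx≤i))
    by-cases (no x≰i) (no sx≰i) =
      subst₂ edge-at (sym (skip-> w x≰i)) (sym (skip-> w sx≰i))
        (walk (x + d) (+-monoˡ-< d x<t))

  shorter-walk : ∀ t w → size A < t → IsWalk w t →
                 ∃ λ t′ → ∃ λ w′ → t′ < t × w′ 0 ≡ w 0 × w′ t′ ≡ w t × IsWalk w′ t′
  shorter-walk t w K<t walk
    with Fin.pigeonhole (n<1+n (size A)) (λ r → encode A (w (toℕ r)))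
  ... | i , j , i<j , same
    with m≤n⇒∃[o]m+o≡n i<j | m≤n⇒∃[o]m+o≡n (≤-<-trans (≤-pred (Fin.toℕ<n j)) K<t)
  ... | o , i+o≡j | m , j+m≡t =
    t′ , skip w (toℕ i) (suc o) , t′<t , skip-≤ w {toℕ i} {suc o} z≤n ,
    trans (skip-> w t′≰i) (cong w (sym t≡t′+d)) , skip-walk w loop (subst (IsWalk w) t≡t′+d walk)
    where
    t′ : ℕ
    t′ = toℕ i + suc m
    t′≰i : ¬ t′ ≤ toℕ i
    t′≰i t′≤i = 1+n≰n (≤-trans (m≤m+n (suc (toℕ i)) m) (subst (_≤ toℕ i) (+-suc (toℕ i) m) t′≤i))
    t≡t′+d : t ≡ t′ + suc o
    t≡t′+d = trans (sym j+m≡t) (trans (cong (λ y → suc y + m) (sym i+o≡j)) (arith (toℕ i) o m))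
      where
      arith : ∀ i o m → suc (suc i + o) + m ≡ i + suc m + suc o
      arith = solve-∀
    t′<t : t′ < t
    t′<t = subst (t′ <_) (sym t≡t′+d) (m<m+n t′ (s≤s z≤n))
    loop : w (toℕ i) ≡ w (toℕ i + suc o)
    loop = trans (encode-injective A same) (cong w (trans (sym i+o≡j) (sym (+-suc (toℕ i) o))))

  reachable-complete : ∀ t w → IsWalk w t → T (reachable (w 0) (w t))
  reachable-complete = <-rec _ shorten
    where
    shorten : ∀ t → (∀ {t′} → t′ < t → ∀ w → IsWalk w t′ → T (reachable (w 0) (w t′))) →
              ∀ w → IsWalk w t → T (reachable (w 0) (w t))
    shorten t rec w walk with t ≤? size A
    ... | yes t≤K = any⁺ _ (lose (∈-upTo⁺ (s≤s t≤K)) (reachableIn-complete t w walk))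
    ... | no  t≰K with shorter-walk t w (≰⇒> t≰K) walk
    ... | t′ , w′ , t′<t , start , end , walk′ =
      subst₂ (λ a b → T (reachable a b)) start end (rec t′<t w′ walk′)

module FairPaths
  (A : FinSet) (initial : Carrier A → Bool) (edge : Carrier A → Carrier A → Bool)
  {E : Set} (obligations : List E) (∈-obligations : ∀ e → e ∈ obligations)
  (pending fulfilled : Carrier A → E → Bool)
  (pending-persists : ∀ {a b} e → T (edge a b) →
                      T (pending a e) → ¬ T (fulfilled a e) → T (pending b e))
  where

  open Reachability A edge

  private
    Node : Set
    Node = Carrier A

  IsInfiniteWalk : (ℕ → Node) → Set
  IsInfiniteWalk s = ∀ i → T (edge (s i) (s (suc i)))

  IsFair : (ℕ → Node) → Set
  IsFair s = ∀ i e → T (pending (s i) e) → ∃ λ j → T (fulfilled (s (j + i)) e)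

  FairPath : Set
  FairPath = ∃ λ s → T (initial (s 0)) × IsInfiniteWalk s × IsFair s

  -- A fair path exists iff some node u, reachable from an initial node, lies
  -- on a cycle and each obligation pending at u is fulfilled in the strongly
  -- connected component of u: the lasso can then cycle through all of them.
  discharged : Node → E → Bool
  discharged u e = not (pending u e) ∨ exists A (λ w → fulfilled w e ∧ (reachable u w ∧ reachable w u))

  lasso : Node → Node → Bool
  lasso u₀ u = initial u₀ ∧ (reachable u₀ u ∧ (onCycle ∧ all (discharged u) obligations))
    where
    onCycle : Bool
    onCycle = exists A (λ c → edge u c ∧ reachable c u)

  fairPath? : Bool
  fairPath? = exists A (λ u₀ → exists A (lasso u₀))

  FulfilledOn : List Node → E → Set
  FulfilledOn xs e = ∃ λ y → y ∈ xs × T (fulfilled y e)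

  fulfilledOn-∷ : ∀ {x xs e} → FulfilledOn xs e → FulfilledOn (x ∷ xs) e
  fulfilledOn-∷ (y , y∈ , f) = y , there y∈ , f

  _∷ˢ_ : Node → (ℕ → Node) → ℕ → Node
  (a ∷ˢ s) zero    = a
  (a ∷ˢ s) (suc i) = s i

  _++ˢ_ : List Node → (ℕ → Node) → ℕ → Node
  []       ++ˢ s = s
  (x ∷ xs) ++ˢ s = x ∷ˢ (xs ++ˢ s)

  ∷ˢ-fair : ∀ a s → T (edge a (s 0)) → IsInfiniteWalk s → IsFair s →
            IsInfiniteWalk (a ∷ˢ s) × IsFair (a ∷ˢ s)
  ∷ˢ-fair a s a→s₀ walk fair = walk′ , fair′
    where
    walk′ : IsInfiniteWalk (a ∷ˢ s)
    walk′ zero    = a→s₀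
    walk′ (suc i) = walk i

    fair′ : IsFair (a ∷ˢ s)
    fair′ zero e p with T? (fulfilled a e)
    ... | yes f = 0 , f
    ... | no ¬f with fair 0 e (pending-persists e a→s₀ p ¬f)
    ...   | j , f = suc j , f
    fair′ (suc i) e p with fair i e p
    ... | j , f = j , subst (λ x → T (fulfilled ((a ∷ˢ s) x) e)) (sym (+-suc j i)) f

  ++ˢ-fair : ∀ {a b} xs s → Walk a xs b → T (edge b (s 0)) → IsInfiniteWalk s → IsFair s →
             IsInfiniteWalk ((a ∷ xs) ++ˢ s) × IsFair ((a ∷ xs) ++ˢ s)
  ++ˢ-fair {a} []       s refl     b→s₀ walk fair = ∷ˢ-fair a s b→s₀ walk fair
  ++ˢ-fair {a} (x ∷ xs) s (e , w) b→s₀ walk fair with ++ˢ-fair xs s w b→s₀ walk fair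
  ... | walk′ , fair′ = ∷ˢ-fair a ((x ∷ xs) ++ˢ s) e walk′ fair′

  rotate : Node → List Node → Node × List Node
  rotate x []       = x , []
  rotate x (y ∷ ys) = y , ys ∷ʳ x

  rotate-↭ : ∀ x xs → x ∷ xs ↭ proj₁ (rotate x xs) ∷ proj₂ (rotate x xs)
  rotate-↭ x []       = ↭-refl
  rotate-↭ x (y ∷ ys) = ∷↭∷ʳ x (y ∷ ys)

  -- x ∷ xs repeated forever, obtained by rotating the list at every step.
  cycle : Node → List Node → ℕ → Node
  cycle x xs zero    = x
  cycle x xs (suc i) = cycle (proj₁ (rotate x xs)) (proj₂ (rotate x xs)) i

  ClosedWalk : Node → List Node → Set
  ClosedWalk x xs = Walk x (xs ∷ʳ x) x

  rotate-closed : ∀ x xs → ClosedWalk x xs → ClosedWalk (proj₁ (rotate x xs)) (proj₂ (rotate x xs))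
  rotate-closed x []       w       = w
  rotate-closed x (y ∷ ys) (e , w) = walk-++ (ys ∷ʳ x) w (e , refl)

  cycle-walk : ∀ x xs → ClosedWalk x xs → IsInfiniteWalk (cycle x xs)
  cycle-walk x []       (e , _) zero    = e
  cycle-walk x (y ∷ ys) (e , _) zero    = e
  cycle-walk x xs       w       (suc i) = cycle-walk _ _ (rotate-closed x xs w) i

  cycle-visits : ∀ x xs {z} → z ∈ x ∷ xs → ∃ λ r → cycle x xs r ≡ z
  cycle-visits x xs (here refl) = 0 , refl
  cycle-visits x xs (there z∈xs) with ∈-∃++ z∈xs
  ... | as , bs , refl = suc (length as) , after as x bs
    where
    after : ∀ as x bs {z} → cycle x (as ++ z ∷ bs) (suc (length as)) ≡ z
    after []       x bs = refl
    after (a ∷ as) x bs {z} =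
      subst (λ l → cycle a l (suc (length as)) ≡ z) (sym (++-assoc as (z ∷ bs) (x ∷ [])))
        (after as a (bs ∷ʳ x))

  Recurrent : Node → List Node → Set
  Recurrent x xs = ∀ {z} e → z ∈ x ∷ xs → T (pending z e) → FulfilledOn (x ∷ xs) e

  -- Every node of the cycle is visited again after any position, so an
  -- obligation fulfilled somewhere on it is fulfilled in the future.
  cycle-fair : ∀ x xs → Recurrent x xs → IsFair (cycle x xs)
  cycle-fair x xs rec zero e p with rec e (here refl) p
  ... | y , y∈ , f with cycle-visits x xs y∈
  ...   | r , eq =
    r , subst (λ v → T (fulfilled v e)) (sym (trans (cong (cycle x xs) (+-identityʳ r)) eq)) f
  cycle-fair x xs rec (suc i) e p with cycle-fair _ _ rec′ i e p
    where
    σ : x ∷ xs ↭ proj₁ (rotate x xs) ∷ proj₂ (rotate x xs)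
    σ = rotate-↭ x xs
    rec′ : Recurrent (proj₁ (rotate x xs)) (proj₂ (rotate x xs))
    rec′ e z∈ p with rec e (∈-resp-↭ (↭-sym σ) z∈) p
    ... | y , y∈ , f = y , ∈-resp-↭ σ y∈ , f
  ... | j , f = j , subst (λ v → T (fulfilled (cycle x xs v) e)) (sym (+-suc j i)) f

  walk-end : ∀ {a b} xs → Walk a xs b → b ∈ a ∷ xs
  walk-end []       refl    = here refl
  walk-end (x ∷ xs) (_ , w) = there (walk-end xs w)

  walk-obligation : ∀ {a b z} xs e → Walk a xs b → z ∈ a ∷ xs → T (pending z e) →
                    FulfilledOn (a ∷ xs) e ⊎ T (pending b e)
  walk-obligation []       e refl      (here refl) p = inj₂ p
  walk-obligation (x ∷ xs) e (a→x , w) (here refl) p with T? (fulfilled _ e)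
  ... | yes f = inj₁ (_ , here refl , f)
  ... | no ¬f = map₁ fulfilledOn-∷ (walk-obligation xs e w (here refl) (pending-persists e a→x p ¬f))
  walk-obligation (x ∷ xs) e (_ , w)   (there z∈) p = map₁ fulfilledOn-∷ (walk-obligation xs e w z∈ p)

  Detour : Node → E → Set
  Detour u e = ∃ λ ds → Walk u ds u × (T (pending u e) → FulfilledOn (u ∷ ds) e)

  detour : ∀ u e → T (discharged u e) → Detour u e
  detour u e d with to T-∨ d
  ... | inj₁ ¬p = [] , refl , λ p → ⊥-elim (to T-not ¬p p)
  ... | inj₂ ex with exists-sound A _ ex
  ... | w , f∧r with to T-∧ f∧r
  ... | f , r with to T-∧ r
  ... | u⇝w , w⇝u with reachable-sound u⇝w | reachable-sound w⇝u
  ... | ys , wy | zs , wz = ys ++ zs , walk-++ ys wy wz , λ _ → w , ∈-++⁺ˡ (walk-end ys wy) , f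

  detours : ∀ {u es} → All (Detour u) es → List Node
  detours []       = []
  detours (d ∷ ds) = proj₁ d ++ detours ds

  detours-walk : ∀ {u es} (ds : All (Detour u) es) → Walk u (detours ds) u
  detours-walk []                    = refl
  detours-walk ((xs , w , _) ∷ ds) = walk-++ xs w (detours-walk ds)

  detours-fulfil : ∀ {u es e} (ds : All (Detour u) es) → e ∈ es → T (pending u e) →
                   FulfilledOn (u ∷ detours ds) e
  detours-fulfil ((xs , _ , ful) ∷ ds) (here refl) p with ful p
  ... | y , y∈ , f = y , ∈-++⁺ˡ y∈ , f
  detours-fulfil ((xs , _ , _) ∷ ds) (there e∈) p with detours-fulfil ds e∈ p
  ... | y , here refl , f = y , here refl , f
  ... | y , there y∈ , f = y , there (∈-++⁺ʳ xs y∈) , f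

  lasso-path : ∀ {u₀ u c} ps cs → T (initial u₀) → Walk u₀ ps u → T (edge u c) → Walk c cs u →
               All (Detour u) obligations → FairPath
  lasso-path {u₀} {u} {c} ps cs i₀ prefix u→c c⇝u ds =
    (u₀ ∷ ps) ++ˢ cycle c L , i₀ ,
    ++ˢ-fair ps (cycle c L) prefix u→c (cycle-walk c L closed) (cycle-fair c L recurrent)
    where
    L : List Node
    L = cs ++ detours ds

    toU : Walk c L u
    toU = walk-++ cs c⇝u (detours-walk ds)

    closed : ClosedWalk c L
    closed = walk-++ L toU (u→c , refl)

    recurrent : Recurrent c L
    recurrent e z∈ p with walk-obligation L e toU z∈ p
    ... | inj₁ found = found
    ... | inj₂ pᵤ with detours-fulfil ds (∈-obligations e) pᵤ
    ...   | y , here refl , f = y , walk-end L toU , f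
    ...   | y , there y∈ , f = y , there (∈-++⁺ʳ cs y∈) , f

  fairPath?-sound : T fairPath? → FairPath
  fairPath?-sound h with exists-sound A _ h
  ... | u₀ , h′ with exists-sound A _ h′
  ... | u , l with to T-∧ l
  ... | i₀ , l₁ with to T-∧ l₁
  ... | u₀⇝u , l₂ with to T-∧ l₂
  ... | loop , disch with exists-sound A _ loop
  ... | c , e∧r with to T-∧ e∧r
  ... | u→c , c⇝u with reachable-sound u₀⇝u | reachable-sound c⇝u
  ... | ps , prefix | cs , back =
    lasso-path ps cs i₀ prefix u→c back (All.map (λ {e} → detour u e) (all⁺ _ obligations disch))

  module Checkpoints {s : ℕ → Node} (walk : IsInfiniteWalk s) (fair : IsFair s) where

    segment-reachable : ∀ {x y} → x ≤ y → T (reachable (s x) (s y))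
    segment-reachable {x} {y} x≤y =
      subst (λ z → T (reachable (s x) (s z))) (m∸n+n≡m x≤y)
        (reachable-complete (y ∸ x) (λ z → s (z + x)) (λ z _ → walk (z + x)))

    delay : ℕ → E → ℕ
    delay i e with T? (pending (s i) e)
    ... | yes p = proj₁ (fair i e p)
    ... | no  _ = 0

    delay-fulfils : ∀ i e → T (pending (s i) e) → T (fulfilled (s (delay i e + i)) e)
    delay-fulfils i e p with T? (pending (s i) e)
    ... | yes p′ = proj₂ (fair i e p′)
    ... | no  ¬p = ⊥-elim (¬p p)

    horizon : ℕ → ℕ
    horizon i = max 0 (map (delay i) obligations)

    delay≤horizon : ∀ i e → delay i e ≤ horizon i
    delay≤horizon i e = v≤max⁺ 0 _ (inj₂ (lose (∈-map⁺ (delay i) (∈-obligations e)) ≤-refl))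

    -- Consecutive checkpoints are far enough apart that every obligation
    -- pending at one checkpoint is fulfilled before the next.
    checkpoint : ℕ → ℕ
    checkpoint zero    = 0
    checkpoint (suc r) = suc (checkpoint r + horizon (checkpoint r))

    checkpoint-mono : ∀ {r r′} → r ≤′ r′ → checkpoint r ≤ checkpoint r′
    checkpoint-mono ≤′-refl      = ≤-refl
    checkpoint-mono (≤′-step r≤r′) = m≤n⇒m≤1+n (≤-trans (checkpoint-mono r≤r′) (m≤m+n _ _))

    lasso-at-checkpoints : ∀ {a b} → T (initial (s 0)) → suc (a + horizon a) ≤ b → s a ≡ s b →
                           T (lasso (s 0) (s a))
    lasso-at-checkpoints {a} {b} i₀ gap same-node =
      from T-∧ (i₀ , from T-∧ (segment-reachable z≤n ,
                from T-∧ (loop , all⁻ _ (All.tabulate discharged-at))))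
      where
      back : ∀ {x} → x ≤ b → T (reachable (s x) (s a))
      back {x} x≤b = subst (λ v → T (reachable (s x) v)) (sym same-node) (segment-reachable x≤b)

      loop : T (exists A (λ c → edge (s a) c ∧ reachable c (s a)))
      loop = exists-complete A _ (s (suc a))
               (from T-∧ (walk a , back (≤-trans (s≤s (m≤m+n a _)) gap)))

      discharged-at : ∀ {e} → e ∈ obligations → T (discharged (s a) e)
      discharged-at {e} _ with T? (pending (s a) e)
      ... | no  ¬p = from T-∨ (inj₁ (from T-not ¬p))
      ... | yes p  = from T-∨ (inj₂ (exists-complete A _ (s (delay a e + a))
                       (from T-∧ (delay-fulfils a e p ,
                        from T-∧ (segment-reachable (m≤n+m a _) , back fulfilled-in-time)))))
        where
        fulfilled-in-time : delay a e + a ≤ b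
        fulfilled-in-time = ≤-trans (≤-trans (≤-reflexive (+-comm (delay a e) a))
                              (m≤n⇒m≤1+n (+-monoʳ-≤ a (delay≤horizon a e)))) gap

  fairPath?-complete : FairPath → T fairPath?
  fairPath?-complete (s , i₀ , walk , fair)
    with Fin.pigeonhole (n<1+n (size A)) (λ r → encode A (s (Checkpoints.checkpoint walk fair (toℕ r))))
  ... | ri , rj , ri<rj , same =
    exists-complete A _ (s 0) (exists-complete A _ (s (checkpoint (toℕ ri)))
      (lasso-at-checkpoints i₀ (checkpoint-mono (≤⇒≤′ ri<rj)) (encode-injective A same)))
    where open Checkpoints walk fair

record Kripke (Λ : Set) : Set₁ where
  field
    states  : FinSet
    initial : Carrier states → Bool
    edge    : Carrier states → Carrier states → Bool
    label   : Carrier states → Λ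

  State : Set
  State = Carrier states

  IsPath : (ℕ → State) → Set
  IsPath p = T (initial (p 0)) × (∀ i → T (edge (p i) (p (suc i))))

open Kripke public using (State; IsPath)

tracks : ∀ {n k} (K : Kripke (Letters n k)) → (ℕ → State K) → Vector (Trace n) k
tracks K p π i = Kripke.label K (p i) π

record SomePath {n k ℓ} (K : Kripke (Letters n k)) (P : Vector (Trace n) k → Set ℓ) : Set ℓ where
  constructor somePath
  field
    witness   : ℕ → State K
    isPath    : IsPath K witness
    satisfies : P (tracks K witness)

record EveryPath {n k ℓ} (K : Kripke (Letters n k)) (P : Vector (Trace n) k → Set ℓ) : Set ℓ where
  constructor everyPath
  field
    onPath : ∀ p → IsPath K p → P (tracks K p)

module PathSearch {n k} (K : Kripke (Letters n k)) (ψ : PathFormula n k) where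
  open Tableau
  open Kripke K

  productStates : FinSet
  productStates = states ×ᶠ labelSet ψ

  productInitial : Carrier productStates → Bool
  productInitial (v , ℓ) = initial v ∧ holds ψ ℓ

  productEdge : Carrier productStates → Carrier productStates → Bool
  productEdge (v , ℓ) (v′ , ℓ′) = edge v v′ ∧ ⌊ follows? (label v) ψ ℓ ℓ′ ⌋

  productInitial⇔ : ∀ x → T (productInitial x) ⇔ (T (initial (proj₁ x)) × T (holds ψ (proj₂ x)))
  productInitial⇔ _ = T-∧

  productEdge⇔ : ∀ x y → T (productEdge x y) ⇔
                 (T (edge (proj₁ x) (proj₁ y)) × Follows (label (proj₁ x)) ψ (proj₂ x) (proj₂ y))
  productEdge⇔ (v , ℓ) (v′ , ℓ′) = (⇔-id _ ×-⇔ T-⌊⌋ (follows? (label v) ψ ℓ ℓ′)) ⇔-∘ T-∧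

  open FairPaths productStates productInitial productEdge
    (eventualities ψ) (∈-eventualities ψ)
    (λ (_ , ℓ) → pending ψ ℓ) (λ (_ , ℓ) → fulfilled ψ ℓ)
    (λ {x} {y} e x→y → pending-persists ψ e (proj₂ (to (productEdge⇔ x y) x→y)))

  satisfiable? : Bool
  satisfiable? = fairPath?

  fairPath-satisfies : FairPath → SomePath K (λ Π → Π , 0 ⊨ₚ ψ)
  fairPath-satisfies (s , i₀ , walk , fair) =
    somePath p (proj₁ (to (productInitial⇔ (s 0)) i₀) , proj₁ ∘ steps)
    (to (run-holds (tracks K p) ψ (proj₂ ∘ steps) fair 0) (proj₂ (to (productInitial⇔ (s 0)) i₀)))
    where
    p : ℕ → Kripke.State K
    p = proj₁ ∘ s
    steps : ∀ i → T (edge (p i) (p (suc i))) × Follows (label (p i)) ψ (proj₂ (s i)) (proj₂ (s (suc i)))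
    steps i = to (productEdge⇔ (s i) (s (suc i))) (walk i)

  satisfiable?-sound : T satisfiable? → SomePath K (λ Π → Π , 0 ⊨ₚ ψ)
  satisfiable?-sound = fairPath-satisfies ∘ fairPath?-sound

  satisfiable?-complete : ExcludedMiddle lzero → SomePath K (λ Π → Π , 0 ⊨ₚ ψ) → T satisfiable?
  satisfiable?-complete em (somePath p (i₀ , steps) sat) =
    fairPath?-complete
      ( (λ i → p i , canonical ψ i)
      , from (productInitial⇔ (p 0 , canonical ψ 0)) (i₀ , from (canonical-holds ψ 0) sat)
      , (λ i → from (productEdge⇔ (p i , canonical ψ i) _) (steps i , canonical-run ψ i))
      , canonical-fair ψ)
    where open Canonical em (tracks K p)

infix 4 _≋_

_≋_ : ∀ {n f} → Vector (Trace n) f → Vector (Trace n) f → Set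
Π ≋ Π′ = ∀ π i a → Π π i a ≡ Π′ π i a

≋-sym : ∀ {n f} {Π Π′ : Vector (Trace n) f} → Π ≋ Π′ → Π′ ≋ Π
≋-sym eq π i a = sym (eq π i a)

≋-∷ : ∀ {n f} {Π Π′ : Vector (Trace n) f} t → Π ≋ Π′ → (t ∷ᵛ Π) ≋ (t ∷ᵛ Π′)
≋-∷ t eq zero    i a = refl
≋-∷ t eq (suc π) i a = eq π i a

≋-empty : ∀ {n} (Π Π′ : Vector (Trace n) 0) → Π ≋ Π′
≋-empty Π Π′ ()

⊨ₚ-cong : ∀ {n f} {Π Π′ : Vector (Trace n) f} → Π ≋ Π′ → ∀ ψ i → (Π , i ⊨ₚ ψ) ⇔ (Π′ , i ⊨ₚ ψ)
⊨ₚ-cong eq (atom a π)  i = mk⇔ (trans (sym (eq π i a))) (trans (eq π i a))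
⊨ₚ-cong eq (neg ψ)     i = ¬-cong-⇔ (⊨ₚ-cong eq ψ i)
⊨ₚ-cong eq (and ψ χ)   i = ⊨ₚ-cong eq ψ i ×-⇔ ⊨ₚ-cong eq χ i
⊨ₚ-cong eq (next ψ)    i = ⊨ₚ-cong eq ψ (suc i)
⊨ₚ-cong eq (until ψ χ) i = mk⇔
  (λ (j , hχ , hψ) → j , to (⊨ₚ-cong eq χ _) hχ , λ k k<j → to (⊨ₚ-cong eq ψ _) (hψ k k<j))
  (λ (j , hχ , hψ) → j , from (⊨ₚ-cong eq χ _) hχ , λ k k<j → from (⊨ₚ-cong eq ψ _) (hψ k k<j))

Sat-cong : ∀ {n f s} {S : TraceSet n} {Π Π′ : Vector (Trace n) f} {Δ : Vector (TraceSet n) s} →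
           Π ≋ Π′ → ∀ φ → Sat S Π Δ φ → Sat S Π′ Δ φ
Sat-cong eq (∀π∈ Y ∙ φ) h t t∈Y          = Sat-cong (≋-∷ t eq) φ (h t t∈Y)
Sat-cong eq (∃π∈ Y ∙ φ) (t , t∈Y , h)    = t , t∈Y , Sat-cong (≋-∷ t eq) φ h
Sat-cong eq (∀X∙ φ)     h A              = Sat-cong eq φ (h A)
Sat-cong eq (∃X∙ φ)     (A , h)          = A , Sat-cong eq φ h
Sat-cong eq (path ψ)    (lift h)         = lift (to (⊨ₚ-cong eq ψ 0) h)

module _ {n : ℕ} where

  Preserved : ∀ {f s} → (TraceSet n → TraceSet n → Set) → Formula n f s → Set₁
  Preserved {f} {s} R φ = ∀ {S : TraceSet n} {Π : Vector (Trace n) f} {Δ Δ′ : Vector (TraceSet n) s} →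
                          (∀ x → R (Δ x) (Δ′ x)) → Sat S Π Δ φ → Sat S Π Δ′ φ

  ⟦⟧ᵛ-mono : ∀ {s} {S : TraceSet n} {Δ Δ′ : Vector (TraceSet n) s} →
             (∀ x → Δ x ⊆ Δ′ x) → ∀ Y → ⟦ Y ⟧ᵛ S Δ ⊆ ⟦ Y ⟧ᵛ S Δ′
  ⟦⟧ᵛ-mono Δ⊆Δ′ 𝔖       = id
  ⟦⟧ᵛ-mono Δ⊆Δ′ 𝔄       = id
  ⟦⟧ᵛ-mono Δ⊆Δ′ (var x) = Δ⊆Δ′ x

  ExistsFO-monotone : ∀ {f s} {φ : Formula n f s} → ExistsFO φ → Preserved _⊆_ φ
  ExistsFO-monotone (base ψ)   Δ⊆Δ′ h               = h
  ExistsFO-monotone (step Y d) Δ⊆Δ′ (t , t∈Y , h) =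
    t , ⟦⟧ᵛ-mono Δ⊆Δ′ Y t∈Y , ExistsFO-monotone d Δ⊆Δ′ h

  ForallFO-antitone : ∀ {f s} {φ : Formula n f s} → ForallFO φ → Preserved _⊇_ φ
  ForallFO-antitone (base ψ)   Δ⊇Δ′ h         = h
  ForallFO-antitone (step Y d) Δ⊇Δ′ h t t∈Y = ForallFO-antitone d Δ⊇Δ′ (h t (⟦⟧ᵛ-mono Δ⊇Δ′ Y t∈Y))

  ForallIn⇒ForallFO : ∀ {f s} {x : Fin s} {φ : Formula n f s} → ForallIn x φ → ForallFO φ
  ForallIn⇒ForallFO (base ψ) = base ψ
  ForallIn⇒ForallFO (step d) = step _ (ForallIn⇒ForallFO d)

  module _ {P : ∀ {f s} → Formula n f s → Set} where

    ∃X-depth : ∀ {f s} {φ : Formula n f s} → ExistsSO P φ → ℕ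
    ∃X-depth {s = s} (base _) = s
    ∃X-depth         (step d) = ∃X-depth d

    ∃X-matrix : ∀ {f s} {φ : Formula n f s} (d : ExistsSO P φ) → Formula n f (∃X-depth d)
    ∃X-matrix {φ = φ} (base _) = φ
    ∃X-matrix         (step d) = ∃X-matrix d

    ∃X-matrix-in : ∀ {f s} {φ : Formula n f s} (d : ExistsSO P φ) → P (∃X-matrix d)
    ∃X-matrix-in (base p) = p
    ∃X-matrix-in (step d) = ∃X-matrix-in d

    ∀X-depth : ∀ {f s} {φ : Formula n f s} → ForallSO P φ → ℕ
    ∀X-depth {s = s} (base _) = s
    ∀X-depth         (step d) = ∀X-depth d

    ∀X-matrix : ∀ {f s} {φ : Formula n f s} (d : ForallSO P φ) → Formula n f (∀X-depth d)
    ∀X-matrix {φ = φ} (base _) = φ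
    ∀X-matrix         (step d) = ∀X-matrix d

    ∀X-matrix-in : ∀ {f s} {φ : Formula n f s} (d : ForallSO P φ) → P (∀X-matrix d)
    ∀X-matrix-in (base p) = p
    ∀X-matrix-in (step d) = ∀X-matrix-in d

    module _ {R : TraceSet n → TraceSet n → Set} (R-refl : ∀ {A} → R A A)
             (P-preserved : ∀ {f s} {φ : Formula n f s} → P φ → Preserved R φ) where

      private
        R-∷ : ∀ {s} {Δ Δ′ : Vector (TraceSet n) s} A →
              (∀ x → R (Δ x) (Δ′ x)) → ∀ x → R ((A ∷ᵛ Δ) x) ((A ∷ᵛ Δ′) x)
        R-∷ A ΔRΔ′ zero    = R-refl
        R-∷ A ΔRΔ′ (suc x) = ΔRΔ′ x

      ExistsSO-preserved : ∀ {f s} {φ : Formula n f s} → ExistsSO P φ → Preserved R φ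
      ExistsSO-preserved (base p) ΔRΔ′ h       = P-preserved p ΔRΔ′ h
      ExistsSO-preserved (step d) ΔRΔ′ (A , h) = A , ExistsSO-preserved d (R-∷ A ΔRΔ′) h

      ForallSO-preserved : ∀ {f s} {φ : Formula n f s} → ForallSO P φ → Preserved R φ
      ForallSO-preserved (base p) ΔRΔ′ h   = P-preserved p ΔRΔ′ h
      ForallSO-preserved (step d) ΔRΔ′ h A = ForallSO-preserved d (R-∷ A ΔRΔ′) (h A)

      -- When satisfaction is preserved along R, an existential second-order
      -- quantifier may be instantiated by an R-greatest set, a universal one by
      -- an R-least set.
      module _ (E : TraceSet n) {f} {S : TraceSet n} {Π : Vector (Trace n) f} where

        ExistsSO-elim : (∀ A → R A E) →
                        ∀ {s} {φ : Formula n f s} (d : ExistsSO P φ) {Δ : Vector (TraceSet n) s} →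
                        (∀ x → R (Δ x) E × R E (Δ x)) → Sat S Π Δ φ ⇔ Sat S Π (λ _ → E) (∃X-matrix d)
        ExistsSO-elim greatest (base p) Δ≈E =
          mk⇔ (P-preserved p (proj₁ ∘ Δ≈E)) (P-preserved p (proj₂ ∘ Δ≈E))
        ExistsSO-elim greatest {φ = ∃X∙ φ} (step d) {Δ} Δ≈E = mk⇔
          (λ (A , h) → to IH (ExistsSO-preserved d (λ { zero → greatest A ; (suc x) → R-refl }) h))
          (λ h → E , from IH h)
          where
          IH : Sat S Π (E ∷ᵛ Δ) φ ⇔ Sat S Π (λ _ → E) (∃X-matrix d)
          IH = ExistsSO-elim greatest d {E ∷ᵛ Δ} (λ { zero → R-refl , R-refl ; (suc x) → Δ≈E x })

        ForallSO-elim : (∀ A → R E A) →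
                        ∀ {s} {φ : Formula n f s} (d : ForallSO P φ) {Δ : Vector (TraceSet n) s} →
                        (∀ x → R (Δ x) E × R E (Δ x)) → Sat S Π Δ φ ⇔ Sat S Π (λ _ → E) (∀X-matrix d)
        ForallSO-elim least (base p) Δ≈E =
          mk⇔ (P-preserved p (proj₁ ∘ Δ≈E)) (P-preserved p (proj₂ ∘ Δ≈E))
        ForallSO-elim least {φ = ∀X∙ φ} (step d) {Δ} Δ≈E = mk⇔
          (λ h → to IH (h E))
          (λ h A → ForallSO-preserved d (λ { zero → least A ; (suc x) → R-refl }) (from IH h))
          where
          IH : Sat S Π (E ∷ᵛ Δ) φ ⇔ Sat S Π (λ _ → E) (∀X-matrix d)
          IH = ForallSO-elim least d {E ∷ᵛ Δ} (λ { zero → R-refl , R-refl ; (suc x) → Δ≈E x })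

Language : ∀ {n} → Kripke (Letter n) → TraceSet n
Language C t = ∃ λ q → IsPath C q × (∀ i a → t i a ≡ Kripke.label C (q i) a)

fromFTS : ∀ {n} → FTS n → Kripke (Letter n)
fromFTS T = record
  { states = Finᶠ (FTS.states T) ; initial = FTS.initial T ; edge = FTS.trans T ; label = FTS.label T }

Language-fromFTS : ∀ {n} (T : FTS n) {t} → Traces T t ⇔ Language (fromFTS T) t
Language-fromFTS T = mk⇔
  (λ (p , i₀ , steps , lab) → p , (from T-≡ i₀ , from T-≡ ∘ steps) , lab)
  (λ (p , (i₀ , steps) , lab) → p , to T-≡ i₀ , to T-≡ ∘ steps , lab)

universal : ∀ {n} → Kripke (Letter n)
universal {n} = record
  { states = Vecᶠ Boolᶠ n ; initial = λ _ → true ; edge = λ _ _ → true ; label = Vec.lookup }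

Language-universal : ∀ {n} (t : Trace n) → Language universal t
Language-universal t =
  (λ i → Vec.tabulate (t i)) , (tt , λ _ → tt) , λ i a → sym (Vecₚ.lookup∘tabulate (t i) a)

empty : ∀ {n} → Kripke (Letter n)
empty = record { states = ⊤ᶠ ; initial = λ _ → false ; edge = λ _ _ → true ; label = λ _ _ → false }

Language-empty : ∀ {n} (t : Trace n) → ¬ Language empty t
Language-empty t (_ , (() , _) , _)

trivial : ∀ {n} → Kripke (Letters n 0)
trivial = record { states = ⊤ᶠ ; initial = λ _ → true ; edge = λ _ _ → true ; label = λ _ () }

infixl 5 _⊗_

_⊗_ : ∀ {n k} → Kripke (Letters n k) → Kripke (Letter n) → Kripke (Letters n (suc k))
K ⊗ C = record
  { states  = Kripke.states K ×ᶠ Kripke.states C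
  ; initial = λ (v , w) → Kripke.initial K v ∧ Kripke.initial C w
  ; edge    = λ (v , w) (v′ , w′) → Kripke.edge K v v′ ∧ Kripke.edge C w w′
  ; label   = λ (v , w) → Kripke.label C w ∷ᵛ Kripke.label K v
  }

module _ {n k} (K : Kripke (Letters n k)) (C : Kripke (Letter n)) where

  IsPath-⊗ : ∀ (p : ℕ → State K) (q : ℕ → State C) →
             IsPath (K ⊗ C) (λ i → p i , q i) ⇔ (IsPath K p × IsPath C q)
  IsPath-⊗ p q = mk⇔
    (λ (i₀ , steps) → (proj₁ (to T-∧ i₀) , proj₁ ∘ to T-∧ ∘ steps) ,
                      (proj₂ (to T-∧ i₀) , proj₂ ∘ to T-∧ ∘ steps))
    (λ ((i₀ , steps) , (j₀ , steps′)) → from T-∧ (i₀ , j₀) , λ i → from T-∧ (steps i , steps′ i))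

  tracks-⊗ : ∀ (p : ℕ → State K) (q : ℕ → State C) t → (∀ i a → t i a ≡ Kripke.label C (q i) a) →
             (t ∷ᵛ tracks K p) ≋ tracks (K ⊗ C) (λ i → p i , q i)
  tracks-⊗ p q t t≡ zero    i a = t≡ i a
  tracks-⊗ p q t t≡ (suc π) i a = refl

  module _ {ℓ} {P : Vector (Trace n) (suc k) → Set ℓ} (P-cong : ∀ {Π Π′} → Π ≋ Π′ → P Π → P Π′) where

    SomePath-⊗ : SomePath (K ⊗ C) P ⇔ SomePath K (λ Π → ∃ λ t → Language C t × P (t ∷ᵛ Π))
    SomePath-⊗ = mk⇔ split join
      where
      split : SomePath (K ⊗ C) P → SomePath K (λ Π → ∃ λ t → Language C t × P (t ∷ᵛ Π))
      split (somePath pq is-path h) =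
        somePath p pathK (t , (q , pathC , λ _ _ → refl) , P-cong (≋-sym (tracks-⊗ p q t λ _ _ → refl)) h)
        where
        p : ℕ → State K
        p = proj₁ ∘ pq
        q : ℕ → State C
        q = proj₂ ∘ pq
        t : Trace n
        t i = Kripke.label C (q i)
        pathK : IsPath K p
        pathK = proj₁ (to (IsPath-⊗ p q) is-path)
        pathC : IsPath C q
        pathC = proj₂ (to (IsPath-⊗ p q) is-path)

      join : SomePath K (λ Π → ∃ λ t → Language C t × P (t ∷ᵛ Π)) → SomePath (K ⊗ C) P
      join (somePath p pathK (t , (q , pathC , t≡) , h)) =
        somePath (λ i → p i , q i) (from (IsPath-⊗ p q) (pathK , pathC)) (P-cong (tracks-⊗ p q t t≡) h)

    EveryPath-⊗ : EveryPath (K ⊗ C) P ⇔ EveryPath K (λ Π → ∀ t → Language C t → P (t ∷ᵛ Π))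
    EveryPath-⊗ = mk⇔ split join
      where
      split : EveryPath (K ⊗ C) P → EveryPath K (λ Π → ∀ t → Language C t → P (t ∷ᵛ Π))
      split (everyPath h) = everyPath λ p pathK t (q , pathC , t≡) →
        P-cong (≋-sym (tracks-⊗ p q t t≡)) (h (λ i → p i , q i) (from (IsPath-⊗ p q) (pathK , pathC)))

      join : EveryPath K (λ Π → ∀ t → Language C t → P (t ∷ᵛ Π)) → EveryPath (K ⊗ C) P
      join (everyPath h) = everyPath joined
        where
        joined : ∀ pq → IsPath (K ⊗ C) pq → P (tracks (K ⊗ C) pq)
        joined pq is-path = P-cong (tracks-⊗ p q t λ _ _ → refl) (h p pathK t (q , pathC , λ _ _ → refl))
          where
          p : ℕ → Kripke.State K
          p = proj₁ ∘ pq
          q : ℕ → State C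
          q = proj₂ ∘ pq
          t : Trace n
          t i = Kripke.label C (q i)
          pathK : IsPath K p
          pathK = proj₁ (to (IsPath-⊗ p q) is-path)
          pathC : IsPath C q
          pathC = proj₂ (to (IsPath-⊗ p q) is-path)

module _ {n k ℓ ℓ′} (K : Kripke (Letters n k))
         {P : Vector (Trace n) k → Set ℓ} {Q : Vector (Trace n) k → Set ℓ′} where

  SomePath-cong : (∀ Π → P Π ⇔ Q Π) → SomePath K P ⇔ SomePath K Q
  SomePath-cong P⇔Q = mk⇔ (λ (somePath p is-path h) → somePath p is-path (to (P⇔Q _) h))
                          (λ (somePath p is-path h) → somePath p is-path (from (P⇔Q _) h))

  EveryPath-cong : (∀ Π → P Π ⇔ Q Π) → EveryPath K P ⇔ EveryPath K Q
  EveryPath-cong P⇔Q = mk⇔ (λ (everyPath h) → everyPath λ p is-path → to (P⇔Q _) (h p is-path))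
                           (λ (everyPath h) → everyPath λ p is-path → from (P⇔Q _) (h p is-path))

module FirstOrder {n s} (S : TraceSet n) (Δ : Vector (TraceSet n) s)
                  (component : SOVar s → Kripke (Letter n))
                  (component-language : ∀ Y {t} → ⟦ Y ⟧ᵛ S Δ t ⇔ Language (component Y) t) where

  open EquationalReasoning

  private
    Holds : ∀ {f} → Formula n f s → Vector (Trace n) f → Set₁
    Holds φ Π = Sat S Π Δ φ

    Holdsₚ : ∀ {f} → PathFormula n f → Vector (Trace n) f → Set
    Holdsₚ ψ Π = Π , 0 ⊨ₚ ψ

  ∃π-width : ∀ {f} {φ : Formula n f s} → ExistsFO φ → ℕ
  ∃π-width {f} (base _)   = f
  ∃π-width     (step _ d) = ∃π-width d

  ∃π-matrix : ∀ {f} {φ : Formula n f s} (d : ExistsFO φ) → PathFormula n (∃π-width d)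
  ∃π-matrix (base ψ)   = ψ
  ∃π-matrix (step _ d) = ∃π-matrix d

  ∃π-structure : ∀ {f} {φ : Formula n f s} (d : ExistsFO φ) →
                 Kripke (Letters n f) → Kripke (Letters n (∃π-width d))
  ∃π-structure (base _)   K = K
  ∃π-structure (step Y d) K = ∃π-structure d (K ⊗ component Y)

  SomePath-ExistsFO : ∀ {f} {φ : Formula n f s} (d : ExistsFO φ) (K : Kripke (Letters n f)) →
                      SomePath K (Holds φ) ⇔ SomePath (∃π-structure d K) (Holdsₚ (∃π-matrix d))
  SomePath-ExistsFO (base ψ) K = SomePath-cong K (λ _ → mk⇔ lower lift)
  SomePath-ExistsFO {φ = ∃π∈ Y ∙ φ} (step Y d) K = begin
    SomePath K (Holds (∃π∈ Y ∙ φ))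
      ∼⟨ SomePath-cong K (λ _ → mk⇔ (λ (t , t∈Y , h) → t , to (component-language Y {t}) t∈Y , h)
                                     (λ (t , t∈C , h) → t , from (component-language Y {t}) t∈C , h)) ⟩
    SomePath K (λ Π → ∃ λ t → Language (component Y) t × Holds φ (t ∷ᵛ Π))
      ∼⟨ ⇔-sym (SomePath-⊗ K (component Y) (λ eq → Sat-cong eq φ)) ⟩
    SomePath (K ⊗ component Y) (Holds φ)
      ∼⟨ SomePath-ExistsFO d (K ⊗ component Y) ⟩
    SomePath (∃π-structure d (K ⊗ component Y)) (Holdsₚ (∃π-matrix d)) ∎

  ∀π-width : ∀ {f} {φ : Formula n f s} → ForallFO φ → ℕ
  ∀π-width {f} (base _)   = f
  ∀π-width     (step _ d) = ∀π-width d

  ∀π-matrix : ∀ {f} {φ : Formula n f s} (d : ForallFO φ) → PathFormula n (∀π-width d)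
  ∀π-matrix (base ψ)   = ψ
  ∀π-matrix (step _ d) = ∀π-matrix d

  ∀π-structure : ∀ {f} {φ : Formula n f s} (d : ForallFO φ) →
                 Kripke (Letters n f) → Kripke (Letters n (∀π-width d))
  ∀π-structure (base _)   K = K
  ∀π-structure (step Y d) K = ∀π-structure d (K ⊗ component Y)

  EveryPath-ForallFO : ∀ {f} {φ : Formula n f s} (d : ForallFO φ) (K : Kripke (Letters n f)) →
                       EveryPath K (Holds φ) ⇔ EveryPath (∀π-structure d K) (Holdsₚ (∀π-matrix d))
  EveryPath-ForallFO (base ψ) K = EveryPath-cong K (λ _ → mk⇔ lower lift)
  EveryPath-ForallFO {φ = ∀π∈ Y ∙ φ} (step Y d) K = begin
    EveryPath K (Holds (∀π∈ Y ∙ φ))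
      ∼⟨ EveryPath-cong K (λ _ → mk⇔ (λ h t t∈C → h t (from (component-language Y {t}) t∈C))
                                      (λ h t t∈Y → h t (to (component-language Y {t}) t∈Y))) ⟩
    EveryPath K (λ Π → ∀ t → Language (component Y) t → Holds φ (t ∷ᵛ Π))
      ∼⟨ ⇔-sym (EveryPath-⊗ K (component Y) (λ eq → Sat-cong eq φ)) ⟩
    EveryPath (K ⊗ component Y) (Holds φ)
      ∼⟨ EveryPath-ForallFO d (K ⊗ component Y) ⟩
    EveryPath (∀π-structure d (K ⊗ component Y)) (Holdsₚ (∀π-matrix d)) ∎

module _ {n ℓ} {P : Vector (Trace n) 0 → Set ℓ} (P-cong : ∀ {Π Π′} → Π ≋ Π′ → P Π → P Π′) where

  SomePath-trivial : ∀ Π₀ → SomePath trivial P ⇔ P Π₀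
  SomePath-trivial Π₀ = mk⇔ (λ (somePath _ _ h) → P-cong (≋-empty _ _) h)
                            (λ h → somePath (λ _ → tt) (tt , λ _ → tt) (P-cong (≋-empty _ _) h))

  EveryPath-trivial : ∀ Π₀ → EveryPath trivial P ⇔ P Π₀
  EveryPath-trivial Π₀ = mk⇔ (λ (everyPath h) → P-cong (≋-empty _ _) (h (λ _ → tt) (tt , λ _ → tt)))
                             (λ h → everyPath λ _ _ → P-cong (≋-empty _ _) h)

universalᵏ : ∀ {n} k → Kripke (Letters n k)
universalᵏ zero    = trivial
universalᵏ (suc k) = universalᵏ k ⊗ universal

SomePath-universalᵏ : ∀ {n ℓ} k {P : Vector (Trace n) k → Set ℓ} → (∀ {Π Π′} → Π ≋ Π′ → P Π → P Π′) →
                      SomePath (universalᵏ k) P ⇔ ∃ P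
SomePath-universalᵏ zero    P-cong =
  mk⇔ (λ h → _ , to (SomePath-trivial P-cong (λ ())) h) (λ (Π , h) → from (SomePath-trivial P-cong Π) h)
SomePath-universalᵏ {n} (suc k) {P} P-cong = begin
  SomePath (universalᵏ k ⊗ universal) P            ∼⟨ SomePath-⊗ (universalᵏ k) universal P-cong ⟩
  SomePath (universalᵏ k) P′                       ∼⟨ SomePath-universalᵏ k P′-cong ⟩
  ∃ P′                                             ∼⟨ mk⇔ (λ (Π , t , _ , h) → t ∷ᵛ Π , h) split ⟩
  ∃ P                                              ∎
  where
  open EquationalReasoning
  P′ : Vector (Trace n) k → Set _
  P′ Π = ∃ λ t → Language universal t × P (t ∷ᵛ Π)

  P′-cong : ∀ {Π Π′} → Π ≋ Π′ → P′ Π → P′ Π′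
  P′-cong eq (t , t∈ , h) = t , t∈ , P-cong (≋-∷ t eq) h

  split : ∃ P → ∃ P′
  split (Π , h) = Π ∘ suc , Π zero , Language-universal (Π zero) , P-cong head∷tail h
    where
    head∷tail : Π ≋ (Π zero ∷ᵛ Π ∘ suc)
    head∷tail zero    i a = refl
    head∷tail (suc π) i a = refl

lower-em : ExcludedMiddle (lsuc lzero) → ExcludedMiddle lzero
lower-em em = map′ lower lift em

open PathSearch using (satisfiable?; satisfiable?-sound; satisfiable?-complete)

valid? : ∀ {n k} → Kripke (Letters n k) → PathFormula n k → Bool
valid? K ψ = not (satisfiable? K (neg ψ))

module _ {n k} (em : ExcludedMiddle lzero) (K : Kripke (Letters n k)) where

  satisfiable?-correct : ∀ ψ → T (satisfiable? K ψ) ⇔ SomePath K (λ Π → Π , 0 ⊨ₚ ψ)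
  satisfiable?-correct ψ = mk⇔ (satisfiable?-sound K ψ) (satisfiable?-complete K ψ em)

  valid?-correct : ∀ ψ → T (valid? K ψ) ⇔ EveryPath K (λ Π → Π , 0 ⊨ₚ ψ)
  valid?-correct ψ = mk⇔ valid⇒every every⇒valid
    where
    counterexample? : Bool
    counterexample? = satisfiable? K (neg ψ)

    valid⇒every : T (valid? K ψ) → EveryPath K (λ Π → Π , 0 ⊨ₚ ψ)
    valid⇒every v = everyPath λ p is-path → decidable-stable em λ ¬h →
      to (T-not {counterexample?}) v (satisfiable?-complete K (neg ψ) em (somePath p is-path ¬h))

    every⇒valid : EveryPath K (λ Π → Π , 0 ⊨ₚ ψ) → T (valid? K ψ)
    every⇒valid (everyPath h) = from (T-not {counterexample?}) λ c →
      refute (satisfiable?-sound K (neg ψ) c)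
      where
      refute : ¬ SomePath K (λ Π → Π , 0 ⊨ₚ neg ψ)
      refute (somePath p is-path ¬h) = ¬h (h p is-path)

module SimpleFragments {n} (𝒯 : FTS n) where

  module Components (C : Kripke (Letter n)) {s : ℕ} where

    component : SOVar s → Kripke (Letter n)
    component 𝔖       = fromFTS 𝒯
    component 𝔄       = universal
    component (var _) = C

    component-language : ∀ Y {t} → ⟦ Y ⟧ᵛ (Traces 𝒯) (λ _ → Language C) t ⇔ Language (component Y) t
    component-language 𝔖       = Language-fromFTS 𝒯
    component-language 𝔄 {t}   = mk⇔ (λ _ → Language-universal t) (λ _ → tt)
    component-language (var _) = ⇔-id _

    open FirstOrder (Traces 𝒯) (λ _ → Language C) component component-language public

  universal-greatest : ∀ (A : TraceSet n) → A ⊆ Language universal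
  universal-greatest A {t} _ = Language-universal t

  empty-least : ∀ (A : TraceSet n) → Language empty ⊆ A
  empty-least A {t} h = ⊥-elim (Language-empty t h)

  check-∃X∃π : ∀ {φ : Sentence n} → ExistsSO ExistsFO φ → Bool
  check-∃X∃π d = satisfiable? (∃π-structure (∃X-matrix-in d) trivial) (∃π-matrix (∃X-matrix-in d))
    where
    open Components universal

  check-∀X∃π : ∀ {φ : Sentence n} → ForallSO ExistsFO φ → Bool
  check-∀X∃π d = satisfiable? (∃π-structure (∀X-matrix-in d) trivial) (∃π-matrix (∀X-matrix-in d))
    where
    open Components empty

  check-∃X∀π : ∀ {φ : Sentence n} → ExistsSO ForallFO φ → Bool
  check-∃X∀π d = valid? (∀π-structure (∃X-matrix-in d) trivial) (∀π-matrix (∃X-matrix-in d))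
    where
    open Components empty

  check-∀X∀π : ∀ {φ : Sentence n} → ForallSO ForallFO φ → Bool
  check-∀X∀π d = valid? (∀π-structure (∀X-matrix-in d) trivial) (∀π-matrix (∀X-matrix-in d))
    where
    open Components universal

  module _ {Π₀ : Vector (Trace n) 0} {Δ₀ : Vector (TraceSet n) 0} where
    open EquationalReasoning

    check-∃X∃π-correct : ExcludedMiddle lzero → ∀ {φ} (d : ExistsSO ExistsFO φ) →
                         T (check-∃X∃π d) ⇔ Sat (Traces 𝒯) Π₀ Δ₀ φ
    check-∃X∃π-correct em {φ} d = begin
      T (check-∃X∃π d)
        ∼⟨ satisfiable?-correct em (∃π-structure m trivial) (∃π-matrix m) ⟩
      SomePath (∃π-structure m trivial) (λ Π → Π , 0 ⊨ₚ ∃π-matrix m)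
        ∼⟨ ⇔-sym (SomePath-ExistsFO m trivial) ⟩
      SomePath trivial (λ Π → Sat (Traces 𝒯) Π (λ _ → Language universal) (∃X-matrix d))
        ∼⟨ SomePath-trivial (λ eq → Sat-cong eq _) Π₀ ⟩
      Sat (Traces 𝒯) Π₀ (λ _ → Language universal) (∃X-matrix d)
        ∼⟨ ⇔-sym (ExistsSO-elim {R = _⊆_} id ExistsFO-monotone (Language universal) universal-greatest d λ ())
        ⟩
      Sat (Traces 𝒯) Π₀ Δ₀ φ ∎
      where
      m : ExistsFO (∃X-matrix d)
      m = ∃X-matrix-in d
      open Components universal

    check-∀X∃π-correct : ExcludedMiddle lzero → ∀ {φ} (d : ForallSO ExistsFO φ) →
                         T (check-∀X∃π d) ⇔ Sat (Traces 𝒯) Π₀ Δ₀ φ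
    check-∀X∃π-correct em {φ} d = begin
      T (check-∀X∃π d)
        ∼⟨ satisfiable?-correct em (∃π-structure m trivial) (∃π-matrix m) ⟩
      SomePath (∃π-structure m trivial) (λ Π → Π , 0 ⊨ₚ ∃π-matrix m)
        ∼⟨ ⇔-sym (SomePath-ExistsFO m trivial) ⟩
      SomePath trivial (λ Π → Sat (Traces 𝒯) Π (λ _ → Language empty) (∀X-matrix d))
        ∼⟨ SomePath-trivial (λ eq → Sat-cong eq _) Π₀ ⟩
      Sat (Traces 𝒯) Π₀ (λ _ → Language empty) (∀X-matrix d)
        ∼⟨ ⇔-sym (ForallSO-elim {R = _⊆_} id ExistsFO-monotone (Language empty) empty-least d λ ()) ⟩
      Sat (Traces 𝒯) Π₀ Δ₀ φ ∎
      where
      m : ExistsFO (∀X-matrix d)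
      m = ∀X-matrix-in d
      open Components empty

    check-∃X∀π-correct : ExcludedMiddle lzero → ∀ {φ} (d : ExistsSO ForallFO φ) →
                         T (check-∃X∀π d) ⇔ Sat (Traces 𝒯) Π₀ Δ₀ φ
    check-∃X∀π-correct em {φ} d = begin
      T (check-∃X∀π d)
        ∼⟨ valid?-correct em (∀π-structure m trivial) (∀π-matrix m) ⟩
      EveryPath (∀π-structure m trivial) (λ Π → Π , 0 ⊨ₚ ∀π-matrix m)
        ∼⟨ ⇔-sym (EveryPath-ForallFO m trivial) ⟩
      EveryPath trivial (λ Π → Sat (Traces 𝒯) Π (λ _ → Language empty) (∃X-matrix d))
        ∼⟨ EveryPath-trivial (λ eq → Sat-cong eq _) Π₀ ⟩
      Sat (Traces 𝒯) Π₀ (λ _ → Language empty) (∃X-matrix d)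
        ∼⟨ ⇔-sym (ExistsSO-elim {R = _⊇_} id ForallFO-antitone (Language empty) empty-least d λ ()) ⟩
      Sat (Traces 𝒯) Π₀ Δ₀ φ ∎
      where
      m : ForallFO (∃X-matrix d)
      m = ∃X-matrix-in d
      open Components empty

    check-∀X∀π-correct : ExcludedMiddle lzero → ∀ {φ} (d : ForallSO ForallFO φ) →
                         T (check-∀X∀π d) ⇔ Sat (Traces 𝒯) Π₀ Δ₀ φ
    check-∀X∀π-correct em {φ} d = begin
      T (check-∀X∀π d)
        ∼⟨ valid?-correct em (∀π-structure m trivial) (∀π-matrix m) ⟩
      EveryPath (∀π-structure m trivial) (λ Π → Π , 0 ⊨ₚ ∀π-matrix m)
        ∼⟨ ⇔-sym (EveryPath-ForallFO m trivial) ⟩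
      EveryPath trivial (λ Π → Sat (Traces 𝒯) Π (λ _ → Language universal) (∀X-matrix d))
        ∼⟨ EveryPath-trivial (λ eq → Sat-cong eq _) Π₀ ⟩
      Sat (Traces 𝒯) Π₀ (λ _ → Language universal) (∀X-matrix d)
        ∼⟨ ⇔-sym (ForallSO-elim {R = _⊇_} id ForallFO-antitone (Language universal) universal-greatest d λ ())
        ⟩
      Sat (Traces 𝒯) Π₀ Δ₀ φ ∎
      where
      m : ForallFO (∀X-matrix d)
      m = ∀X-matrix-in d
      open Components universal

All-concat-map : ∀ {a b p} {A : Set a} {B : Set b} {P : A → Set p} (F : B → List A) xs →
                 All P (concat (map F xs)) ⇔ (∀ {x} → x ∈ xs → All P (F x))
All-concat-map F xs = mk⇔ (All.lookup ∘ All-map⁻ ∘ concat⁻) (concat⁺ ∘ All-map⁺ ∘ All.tabulate)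

module _ {n : ℕ} where

  rename : ∀ {f g} → (Fin f → Fin g) → PathFormula n f → PathFormula n g
  rename ρ (atom a π)  = atom a (ρ π)
  rename ρ (neg ψ)     = neg (rename ρ ψ)
  rename ρ (and ψ χ)   = and (rename ρ ψ) (rename ρ χ)
  rename ρ (next ψ)    = next (rename ρ ψ)
  rename ρ (until ψ χ) = until (rename ρ ψ) (rename ρ χ)

  ⊨ₚ-rename : ∀ {f g} (ρ : Fin f → Fin g) (Π : Vector (Trace n) g) ψ i →
              (Π , i ⊨ₚ rename ρ ψ) ⇔ ((Π ∘ ρ) , i ⊨ₚ ψ)
  ⊨ₚ-rename ρ Π (atom a π)  i = ⇔-id _
  ⊨ₚ-rename ρ Π (neg ψ)     i = ¬-cong-⇔ (⊨ₚ-rename ρ Π ψ i)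
  ⊨ₚ-rename ρ Π (and ψ χ)   i = ⊨ₚ-rename ρ Π ψ i ×-⇔ ⊨ₚ-rename ρ Π χ i
  ⊨ₚ-rename ρ Π (next ψ)    i = ⊨ₚ-rename ρ Π ψ (suc i)
  ⊨ₚ-rename ρ Π (until ψ χ) i = mk⇔
    (λ (j , hχ , hψ) → j , to (⊨ₚ-rename ρ Π χ _) hχ , λ k k<j → to (⊨ₚ-rename ρ Π ψ _) (hψ k k<j))
    (λ (j , hχ , hψ) → j , from (⊨ₚ-rename ρ Π χ _) hχ , λ k k<j → from (⊨ₚ-rename ρ Π ψ _) (hψ k k<j))

  instantiate : ∀ {g} → Fin g → Fin (suc g) → Fin g
  instantiate c zero    = c
  instantiate c (suc π) = π

  Enumerates : ∀ {g} → TraceSet n → List (Fin g) → Vector (Trace n) g → Set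
  Enumerates A cs Π = ∀ {t} → A t ⇔ (∃ λ c → c ∈ cs × Π c ≡ t)

  Enumerates-∷ : ∀ {g A cs} {Π : Vector (Trace n) g} →
                 Enumerates A cs Π → ∀ t → Enumerates A (map suc cs) (t ∷ᵛ Π)
  Enumerates-∷ {cs = cs} {Π} enum t = mk⇔
    (λ t′∈A → let (c , c∈ , eq) = to enum t′∈A in suc c , ∈-map⁺ suc c∈ , eq)
    (λ (c′ , c′∈ , eq) → from enum (lift-index c′∈ eq))
    where
    lift-index : ∀ {c′ t′} → c′ ∈ map suc cs → (t ∷ᵛ Π) c′ ≡ t′ → ∃ λ c → c ∈ cs × Π c ≡ t′
    lift-index c′∈ eq with ∈-map⁻ suc c′∈
    ... | c , c∈ , refl = c , c∈ , eq

  -- The instances of ∀π∈X.φ when X = {Π c | c ∈ cs}: every universally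
  -- quantified variable is replaced by each of the variables in cs.
  instances : ∀ {s} {x : Fin s} {g} {φ : Formula n g s} →
              ForallIn x φ → List (Fin g) → List (PathFormula n g)
  instances (base ψ) cs = ψ ∷ []
  instances (step d) cs = concat (map (λ c → map (rename (instantiate c)) (instances d (map suc cs))) cs)

  instances-correct : ∀ {S s} {x : Fin s} {Δ : Vector (TraceSet n) s} {g} {φ : Formula n g s}
                      (d : ForallIn x φ) cs Π → Enumerates (Δ x) cs Π →
                      Sat S Π Δ φ ⇔ All (λ ψ → Π , 0 ⊨ₚ ψ) (instances d cs)
  instances-correct (base ψ) cs Π enum = mk⇔ (λ h → lower h ∷ []) (λ { (h ∷ []) → lift h })
  instances-correct {S} {x = x} {Δ} {φ = ∀π∈ _ ∙ φ} (step d) cs Π enum = mk⇔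
    (λ h → from (All-concat-map instancesAt cs) λ {c} c∈ →
       All-map⁺ (All.map (λ {ψ} → to (renamed c {ψ})) (to (IH c) (h (Π c) (from enum (c , c∈ , refl))))))
    (λ all t t∈X → let (c , c∈ , Πc≡t) = to enum t∈X in
       subst (λ t → Sat S (t ∷ᵛ Π) Δ φ) Πc≡t
         (from (IH c) (All.map (λ {ψ} → from (renamed c {ψ}))
           (All-map⁻ (to (All-concat-map instancesAt cs) all c∈)))))
    where
    ψs : List (PathFormula n _)
    ψs = instances d (map suc cs)

    instancesAt : Fin _ → List (PathFormula n _)
    instancesAt c = map (rename (instantiate c)) ψs

    IH : ∀ c → Sat S (Π c ∷ᵛ Π) Δ φ ⇔ All (λ ψ → (Π c ∷ᵛ Π) , 0 ⊨ₚ ψ) ψs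
    IH c = instances-correct d (map suc cs) (Π c ∷ᵛ Π) (Enumerates-∷ enum (Π c))

    instantiate-≋ : ∀ c → (Π ∘ instantiate c) ≋ (Π c ∷ᵛ Π)
    instantiate-≋ c zero    i a = refl
    instantiate-≋ c (suc π) i a = refl

    renamed : ∀ c {ψ} → ((Π c ∷ᵛ Π) , 0 ⊨ₚ ψ) ⇔ (Π , 0 ⊨ₚ rename (instantiate c) ψ)
    renamed c {ψ} = ⇔-sym (⊨ₚ-cong (instantiate-≋ c) ψ 0 ⇔-∘ ⊨ₚ-rename (instantiate c) Π ψ 0)

  module _ {s} {x : Fin s} where

    prefix-width : ∀ {f} {φ : Formula n f s} → ExistsForallIn x φ → ℕ
    prefix-width {f} (base _) = f
    prefix-width     (step d) = prefix-width d

    prefix-matrix : ∀ {f} {φ : Formula n f s} (d : ExistsForallIn x φ) → Formula n (prefix-width d) s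
    prefix-matrix {φ = φ} (base _) = φ
    prefix-matrix         (step d) = prefix-matrix d

    prefix-matrix-in : ∀ {f} {φ : Formula n f s} (d : ExistsForallIn x φ) → ForallIn x (prefix-matrix d)
    prefix-matrix-in (base p) = p
    prefix-matrix-in (step d) = prefix-matrix-in d

    prefix-embed : ∀ {f} {φ : Formula n f s} (d : ExistsForallIn x φ) → Fin f → Fin (prefix-width d)
    prefix-embed (base _) j = j
    prefix-embed (step d) j = prefix-embed d (suc j)

    Sat-∃prefix : ∀ {S : TraceSet n} {Δ : Vector (TraceSet n) s} {f} {φ : Formula n f s}
                  (d : ExistsForallIn x φ) (Π : Vector (Trace n) f) → (∀ j → Δ x (Π j)) →
                  Sat S Π Δ φ ⇔ (∃ λ Π′ → (∀ j → Π′ (prefix-embed d j) ≡ Π j) × (∀ j → Δ x (Π′ j)) ×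
                                         Sat S Π′ Δ (prefix-matrix d))
    Sat-∃prefix (base _) Π Π∈X = mk⇔
      (λ h → Π , (λ _ → refl) , Π∈X , h)
      (λ (Π′ , Π′≡Π , _ , h) → Sat-cong (λ π i a → cong (λ t → t i a) (Π′≡Π π)) _ h)
    Sat-∃prefix {Δ = Δ} (step d) Π Π∈X = mk⇔
      (λ (t , t∈X , h) → let (Π′ , Π′≡ , Π′∈X , h′) = to (Sat-∃prefix d (t ∷ᵛ Π) (extend t∈X)) h in
         Π′ , Π′≡ ∘ suc , Π′∈X , h′)
      (λ (Π′ , Π′≡Π , Π′∈X , h′) → let t = Π′ (prefix-embed d zero) in
         t , Π′∈X _ , from (Sat-∃prefix d (t ∷ᵛ Π) (extend (Π′∈X _)))
                        (Π′ , (λ { zero → refl ; (suc j) → Π′≡Π j }) , Π′∈X , h′))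
      where
      extend : ∀ {t} → Δ x t → ∀ j → Δ x ((t ∷ᵛ Π) j)
      extend t∈X zero    = t∈X
      extend t∈X (suc j) = Π∈X j

  range : ∀ {k} → Vector (Trace n) k → TraceSet n
  range Π t = ∃ λ j → Π j ≡ t

  Enumerates-range : ∀ {k} (Π : Vector (Trace n) k) → Enumerates (range Π) (allFin k) Π
  Enumerates-range Π = mk⇔ (λ (j , eq) → j , ∈-allFin j , eq) (λ (j , _ , eq) → j , eq)

  -- The witnesses of the existential trace quantifiers form the smallest
  -- possible choice of X, so the universal quantifiers range over finitely
  -- many traces only.
  Sat-∃X∃π∀π : ∀ {S : TraceSet n} {Π₀ : Vector (Trace n) 0} {Δ₀ : Vector (TraceSet n) 0}
               {φ : Formula n 0 1} (d : ExistsForallIn zero φ) →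
               Sat S Π₀ Δ₀ (∃X∙ φ) ⇔
               ∃ λ Π → All (λ ψ → Π , 0 ⊨ₚ ψ) (instances (prefix-matrix-in d) (allFin _))
  Sat-∃X∃π∀π {S} {Π₀} {Δ₀} d = mk⇔
    (λ (A , h) → let (Π , _ , Π∈A , h′) = to (Sat-∃prefix d Π₀ λ ()) h in
       Π , to (instances-correct m (allFin _) Π (Enumerates-range Π))
              (ForallFO-antitone (ForallIn⇒ForallFO m) (range⊆ Π∈A) h′))
    (λ (Π , all) → range Π ,
       from (Sat-∃prefix d Π₀ λ ())
         (Π , (λ ()) , (λ j → j , refl) , from (instances-correct m (allFin _) Π (Enumerates-range Π)) all))
    where
    m : ForallIn zero (prefix-matrix d)
    m = prefix-matrix-in d

    range⊆ : ∀ {A : TraceSet n} {Π : Vector (Trace n) _} → (∀ j → A (Π j)) →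
             ∀ x → (A ∷ᵛ Δ₀) x ⊇ (range Π ∷ᵛ Δ₀) x
    range⊆ Π∈A zero (j , refl) = Π∈A j

⋀ : ∀ {n k} → PathFormula n k → List (PathFormula n k) → PathFormula n k
⋀ ψ []       = ψ
⋀ ψ (χ ∷ χs) = and ψ (⋀ χ χs)

⊨ₚ-⋀ : ∀ {n k} (Π : Vector (Trace n) k) ψ ψs → (Π , 0 ⊨ₚ ⋀ ψ ψs) ⇔ All (λ χ → Π , 0 ⊨ₚ χ) (ψ ∷ ψs)
⊨ₚ-⋀ Π ψ []       = mk⇔ (_∷ []) (λ { (h ∷ []) → h })
⊨ₚ-⋀ Π ψ (χ ∷ χs) = mk⇔ (λ (h , hs) → h ∷ to (⊨ₚ-⋀ Π χ χs) hs) (λ { (h ∷ hs) → h , from (⊨ₚ-⋀ Π χ χs) hs })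

allSatisfiable? : ∀ {n k} → List (PathFormula n k) → Bool
allSatisfiable?     []       = true
allSatisfiable? {k = k} (ψ ∷ ψs) = satisfiable? (universalᵏ k) (⋀ ψ ψs)

allSatisfiable?-correct : ∀ {n k} → ExcludedMiddle lzero → (ψs : List (PathFormula n k)) →
                          T (allSatisfiable? ψs) ⇔ ∃ λ Π → All (λ ψ → Π , 0 ⊨ₚ ψ) ψs
allSatisfiable?-correct em [] = mk⇔ (λ _ → (λ _ _ _ → false) , []) (λ _ → tt)
allSatisfiable?-correct {k = k} em (ψ ∷ ψs) = begin
  T (satisfiable? (universalᵏ k) (⋀ ψ ψs))        ∼⟨ satisfiable?-correct em (universalᵏ k) (⋀ ψ ψs) ⟩
  SomePath (universalᵏ k) (λ Π → Π , 0 ⊨ₚ ⋀ ψ ψs)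
                                 ∼⟨ SomePath-universalᵏ k (λ eq → to (⊨ₚ-cong eq (⋀ ψ ψs) 0)) ⟩
  (∃ λ Π → Π , 0 ⊨ₚ ⋀ ψ ψs)                        ∼⟨ mk⇔ (λ (Π , h) → Π , to (⊨ₚ-⋀ Π ψ ψs) h)
                                                           (λ (Π , h) → Π , from (⊨ₚ-⋀ Π ψ ψs) h) ⟩
  (∃ λ Π → All (λ χ → Π , 0 ⊨ₚ χ) (ψ ∷ ψs))        ∎
  where open EquationalReasoning

check-∃X∃π∀π : ∀ {n} {φ : Formula n 0 1} → ExistsForallIn zero φ → Bool
check-∃X∃π∀π d = allSatisfiable? (instances (prefix-matrix-in d) (allFin _))

module Recognition {n : ℕ} where

  private
    Is-just-map : ∀ {A B : Set} (f : A → B) {m} → Is-just m → Is-just (Maybe.map f m)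
    Is-just-map f (just _) = just tt

    Is-just-<∣>ˡ : ∀ {A : Set} {a b : Maybe A} → Is-just a → Is-just (a <∣> b)
    Is-just-<∣>ˡ (just _) = just tt

    Is-just-<∣>ʳ : ∀ {A : Set} (a : Maybe A) {b} → Is-just b → Is-just (a <∣> b)
    Is-just-<∣>ʳ (just _) _ = just tt
    Is-just-<∣>ʳ nothing  h = h

  forallFO? : ∀ {f s} (φ : Formula n f s) → Maybe (ForallFO φ)
  forallFO? (∀π∈ Y ∙ φ) = Maybe.map (step Y) (forallFO? φ)
  forallFO? (path ψ)    = just (base ψ)
  forallFO? _           = nothing

  forallFO?-complete : ∀ {f s} {φ : Formula n f s} → ForallFO φ → Is-just (forallFO? φ)
  forallFO?-complete (base ψ)   = just tt
  forallFO?-complete (step Y d) = Is-just-map (step Y) (forallFO?-complete d)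

  existsFO? : ∀ {f s} (φ : Formula n f s) → Maybe (ExistsFO φ)
  existsFO? (∃π∈ Y ∙ φ) = Maybe.map (step Y) (existsFO? φ)
  existsFO? (path ψ)    = just (base ψ)
  existsFO? _           = nothing

  existsFO?-complete : ∀ {f s} {φ : Formula n f s} → ExistsFO φ → Is-just (existsFO? φ)
  existsFO?-complete (base ψ)   = just tt
  existsFO?-complete (step Y d) = Is-just-map (step Y) (existsFO?-complete d)

  module _ {P : ∀ {f s} → Formula n f s → Set} (P? : ∀ {f s} (φ : Formula n f s) → Maybe (P φ))
           (P?-complete : ∀ {f s} {φ : Formula n f s} → P φ → Is-just (P? φ)) where

    existsSO? : ∀ {f s} (φ : Formula n f s) → Maybe (ExistsSO P φ)
    existsSO? φ = Maybe.map base (P? φ) <∣> prefixed φ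
      where
      prefixed : ∀ {f s} (φ : Formula n f s) → Maybe (ExistsSO P φ)
      prefixed (∃X∙ φ) = Maybe.map step (existsSO? φ)
      prefixed _       = nothing

    existsSO?-complete : ∀ {f s} {φ : Formula n f s} → ExistsSO P φ → Is-just (existsSO? φ)
    existsSO?-complete (base p) = Is-just-<∣>ˡ (Is-just-map base (P?-complete p))
    existsSO?-complete {φ = ∃X∙ φ} (step d) =
      Is-just-<∣>ʳ (Maybe.map base (P? (∃X∙ φ))) (Is-just-map step (existsSO?-complete d))

    forallSO? : ∀ {f s} (φ : Formula n f s) → Maybe (ForallSO P φ)
    forallSO? φ = Maybe.map base (P? φ) <∣> prefixed φ
      where
      prefixed : ∀ {f s} (φ : Formula n f s) → Maybe (ForallSO P φ)
      prefixed (∀X∙ φ) = Maybe.map step (forallSO? φ)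
      prefixed _       = nothing

    forallSO?-complete : ∀ {f s} {φ : Formula n f s} → ForallSO P φ → Is-just (forallSO? φ)
    forallSO?-complete (base p) = Is-just-<∣>ˡ (Is-just-map base (P?-complete p))
    forallSO?-complete {φ = ∀X∙ φ} (step d) =
      Is-just-<∣>ʳ (Maybe.map base (P? (∀X∙ φ))) (Is-just-map step (forallSO?-complete d))

  forallIn? : ∀ {f} (φ : Formula n f 1) → Maybe (ForallIn zero φ)
  forallIn? (∀π∈ var zero ∙ φ) = Maybe.map step (forallIn? φ)
  forallIn? (path ψ)           = just (base ψ)
  forallIn? _                  = nothing

  forallIn?-complete : ∀ {f} {φ : Formula n f 1} → ForallIn zero φ → Is-just (forallIn? φ)
  forallIn?-complete (base ψ) = just tt
  forallIn?-complete (step d) = Is-just-map step (forallIn?-complete d)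

  existsForallIn? : ∀ {f} (φ : Formula n f 1) → Maybe (ExistsForallIn zero φ)
  existsForallIn? φ = Maybe.map base (forallIn? φ) <∣> prefixed φ
    where
    prefixed : ∀ {f} (φ : Formula n f 1) → Maybe (ExistsForallIn zero φ)
    prefixed (∃π∈ var zero ∙ φ) = Maybe.map step (existsForallIn? φ)
    prefixed _                  = nothing

  existsForallIn?-complete : ∀ {f} {φ : Formula n f 1} →
                             ExistsForallIn zero φ → Is-just (existsForallIn? φ)
  existsForallIn?-complete (base p) = Is-just-<∣>ˡ (Is-just-map base (forallIn?-complete p))
  existsForallIn?-complete {φ = ∃π∈ _ ∙ φ} (step d) =
    Is-just-<∣>ʳ (Maybe.map base (forallIn? (∃π∈ var zero ∙ φ)))
      (Is-just-map step (existsForallIn?-complete d))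

  ∃X∀π? ∀X∀π? ∃X∃π? ∀X∃π? ∃X∃π∀π? : (φ : Sentence n) → Maybe (InFragment φ)
  ∃X∀π? φ = Maybe.map ∃X∀π (existsSO? forallFO? forallFO?-complete φ)
  ∀X∀π? φ = Maybe.map ∀X∀π (forallSO? forallFO? forallFO?-complete φ)
  ∃X∃π? φ = Maybe.map ∃X∃π (existsSO? existsFO? existsFO?-complete φ)
  ∀X∃π? φ = Maybe.map ∀X∃π (forallSO? existsFO? existsFO?-complete φ)
  ∃X∃π∀π? (∃X∙ φ) = Maybe.map ∃X∃π∀π (existsForallIn? φ)
  ∃X∃π∀π? _       = nothing

  fragment? : (φ : Sentence n) → Maybe (InFragment φ)
  fragment? φ = ∃X∀π? φ <∣> ∀X∀π? φ <∣> ∃X∃π? φ <∣> ∀X∃π? φ <∣> ∃X∃π∀π? φ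

  fragment?-complete : ∀ {φ : Sentence n} → InFragment φ → Is-just (fragment? φ)
  fragment?-complete (∃X∀π d) =
    Is-just-<∣>ˡ (Is-just-map ∃X∀π (existsSO?-complete forallFO? forallFO?-complete d))
  fragment?-complete {φ} (∀X∀π d) = Is-just-<∣>ʳ (∃X∀π? φ) (
    Is-just-<∣>ˡ (Is-just-map ∀X∀π (forallSO?-complete forallFO? forallFO?-complete d)))
  fragment?-complete {φ} (∃X∃π d) = Is-just-<∣>ʳ (∃X∀π? φ) (Is-just-<∣>ʳ (∀X∀π? φ) (
    Is-just-<∣>ˡ (Is-just-map ∃X∃π (existsSO?-complete existsFO? existsFO?-complete d))))
  fragment?-complete {φ} (∀X∃π d) =
    Is-just-<∣>ʳ (∃X∀π? φ) (Is-just-<∣>ʳ (∀X∀π? φ) (Is-just-<∣>ʳ (∃X∃π? φ) (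
      Is-just-<∣>ˡ (Is-just-map ∀X∃π (forallSO?-complete existsFO? existsFO?-complete d)))))
  fragment?-complete {φ} (∃X∃π∀π d) =
    Is-just-<∣>ʳ (∃X∀π? φ) (Is-just-<∣>ʳ (∀X∀π? φ) (Is-just-<∣>ʳ (∃X∃π? φ) (Is-just-<∣>ʳ (∀X∃π? φ) (
      Is-just-map ∃X∃π∀π (existsForallIn?-complete d)))))

open Recognition using (fragment?; fragment?-complete)

check : ∀ {n} → FTS n → {φ : Sentence n} → InFragment φ → Bool
check 𝒯 (∃X∀π d)    = SimpleFragments.check-∃X∀π 𝒯 d
check 𝒯 (∀X∀π d)    = SimpleFragments.check-∀X∀π 𝒯 d
check 𝒯 (∃X∃π d)    = SimpleFragments.check-∃X∃π 𝒯 d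
check 𝒯 (∀X∃π d)    = SimpleFragments.check-∀X∃π 𝒯 d
check 𝒯 (∃X∃π∀π d) = check-∃X∃π∀π d

check-correct : ∀ {n} → ExcludedMiddle lzero → (𝒯 : FTS n) {φ : Sentence n} (fr : InFragment φ) →
                T (check 𝒯 fr) ⇔ 𝒯 ⊨ φ
check-correct em 𝒯 (∃X∀π d)    = SimpleFragments.check-∃X∀π-correct 𝒯 em d
check-correct em 𝒯 (∀X∀π d)    = SimpleFragments.check-∀X∀π-correct 𝒯 em d
check-correct em 𝒯 (∃X∃π d)    = SimpleFragments.check-∃X∃π-correct 𝒯 em d
check-correct em 𝒯 (∀X∃π d)    = SimpleFragments.check-∀X∃π-correct 𝒯 em d
check-correct em 𝒯 (∃X∃π∀π d) = ⇔-sym (Sat-∃X∃π∀π d) ⇔-∘ allSatisfiable?-correct em _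

decide : ∀ {n} → FTS n → Sentence n → Bool
decide 𝒯 φ = maybe′ (check 𝒯) false (fragment? φ)

decide-correct : ∀ {n} → ExcludedMiddle lzero → (𝒯 : FTS n) (φ : Sentence n) → InFragment φ →
                 T (decide 𝒯 φ) ⇔ 𝒯 ⊨ φ
decide-correct em 𝒯 φ fr = via (fragment? φ) (fragment?-complete fr)
  where
  via : (m : Maybe (InFragment φ)) → Is-just m → T (maybe′ (check 𝒯) false m) ⇔ 𝒯 ⊨ φ
  via (just fr′) _ = check-correct em 𝒯 fr′

proposition5 : (n : ℕ) →
    Σ[ decide ∈ (FTS n → Sentence n → Bool) ]
      (ExcludedMiddle (lsuc lzero) →
        (T : FTS n) (φ : Sentence n) → InFragment φ →
        (decide T φ ≡ true) ⇔ (T ⊨ φ))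
proposition5 n = decide , λ em 𝒯 φ fr →
  decide-correct (lower-em em) 𝒯 φ fr ⇔-∘ ⇔-sym (T-≡ {decide 𝒯 φ})
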